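{- Let $n$ be a positive integer. Then (a) $\tau_{14}(2n+1)\equiv R_8(n)\pmod 2$; (b) $\tau_6(2n+1)\equiv 1\pmod 2$ if $n=\frac{m(m+1)}{2}$ for some integer $m$, and $\tau_6(2n+1)\equiv 0\pmod 2$ otherwise.
   Context: For a nonzero integer $k$, $\tau_k$ is defined by $q\prod_{m=1}^{\infty}(1-q^m)^k=\sum_{n=1}^{\infty}\tau_k(n)q^n$. For an integer $t\geq2$, $R_t(n)$ is the number of partitions of $n$ with no part divisible by $t$. -}

module Defs where

open import Data.Nat using (ℕ; zero; suc; _+_; _*_; _∸_; _≤_; _<_; _%_)
open import Data.Integer as ℤ using (ℤ)
open import Data.List using (List; []; _∷_; map; replicate; length)
open import Data.Bool using (Bool; true; false; if_then_else_; _∧_; not)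
import Data.Nat
open import Relation.Nullary.Decidable using (⌊_⌋)
open import Data.Nat.Properties using (_≟_)

-- Truncated power series over ℤ: coefficient functions ℕ → ℤ (only
-- coefficients of index ≤ N are ever inspected).
Series : Set
Series = ℕ → ℤ

convAux : Series → Series → ℕ → ℕ → ℤ
convAux f g n zero    = f 0 ℤ.* g n
convAux f g n (suc i) = f (suc i) ℤ.* g (n ∸ suc i) ℤ.+ convAux f g n i

_·_ : Series → Series → Series
(f · g) n = convAux f g n n

one : Series
one zero    = ℤ.1ℤ
one (suc _) = ℤ.0ℤ

oneMinusQ^ : ℕ → Series
oneMinusQ^ m zero    = ℤ.1ℤ
oneMinusQ^ m (suc j) = if ⌊ suc j ≟ m ⌋ then ℤ.-1ℤ else ℤ.0ℤ

-- ∏_{m=1}^{N} (1 - q^m); agrees with the infinite product in degrees ≤ N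
eulerPartial : ℕ → Series
eulerPartial zero    = one
eulerPartial (suc N) = eulerPartial N · oneMinusQ^ (suc N)

_^ˢ_ : Series → ℕ → Series
f ^ˢ zero  = one
f ^ˢ suc k = (f ^ˢ k) · f

-- τ_k(n) for positive k: coefficient of q^n in q ∏_{m≥1}(1-q^m)^k,
-- i.e. the coefficient of q^(n-1) in ∏_{m≥1}(1-q^m)^k, for n ≥ 1.
-- (Using the partial product up to m = n is exact in degree n - 1.)
τ : ℕ → ℕ → ℤ
τ k zero    = ℤ.0ℤ
τ k (suc n) = (eulerPartial (suc n) ^ˢ k) n

-- P t b n = number of partitions of n into parts ≤ b, none divisible by t.
divisibleBy : ℕ → ℕ → Bool
divisibleBy t b = ⌊ b % suc (t ∸ 1) ≟ 0 ⌋

mutual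
  P : ℕ → ℕ → ℕ → ℕ
  P t zero    zero    = 1
  P t zero    (suc _) = 0
  P t (suc b) n = sumMult t b n n

  sumMult : ℕ → ℕ → ℕ → ℕ → ℕ
  sumMult t b n zero    = P t b n
  sumMult t b n (suc c) =
    sumMult t b n c +
    (if ⌊ suc c * suc b Data.Nat.≤? n ⌋ ∧ not (divisibleBy t (suc b))
       then P t b (n ∸ suc c * suc b) else 0)

-- R_t(n): number of partitions of n with no part divisible by t
-- (all parts are ≤ n).  Intended for t ≥ 2.
R : ℕ → ℕ → ℕ
R t n = P t n n

-- Modulo 2 the Euler product ∏ (1 - qᵐ) becomes E = ∏ (1 + qᵐ) over 𝔽₂, where squaring is the
-- Frobenius map f(q) ↦ f(q²).
-- (a) E¹⁴ = E¹⁶ / E² = E(q¹⁶) / E(q²), and E(q⁸) / E(q) is the generating function of R₈.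
-- (b) E⁶ = E(q²) E(q⁴) is E(q) E(q²) taken at q². Sorting exponents mod 4,
-- E(q) E(q²) = ∏ (1 + q^(4i+1)) (1 + q^(4i+3)) (1 + q^(4i+4)), the product side of Jacobi's triple
-- product with Q = q⁴ and z = q, whose sum side is Σ_j q^(j(j+1)/2). The triple product is proved in
-- the finite form
--   ∏_{i<a} (1 + z Qⁱ) ∏_{i<b} (z + Q^(i+1)) = Σ_l zˡ Q^((l-b)(l-b-1)/2) [a+b choose l]_Q,
-- and multiplying by (Q; Q)_2n turns the Gaussian binomials into 1 in low degree.
-- Throughout, Euler products are truncated and series are compared modulo a power of q.

module Submission where

open import Defs
open import Data.Nat using (ℕ; zero; suc; _+_; _*_; _∸_; _≤_; _<_; z≤n; s≤s; _≤?_)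
open import Data.Bool using (true; false; if_then_else_; _∧_; not)
import Data.Bool.Properties as 𝔹
open import Relation.Nullary.Decidable using (⌊_⌋; dec-true)
open import Data.Nat.Base using (parity; NonZero; ≢-nonZero⁻¹)
open import Data.Nat.Properties using (_≟_)
import Data.Nat.Properties as ℕ
import Data.Nat.Divisibility as ℕ
open import Data.Nat.DivMod using ([m+kn]%n≡m%n)
open import Data.Nat.Tactic.RingSolver using (solve-∀)
open import Data.Integer as ℤ using (ℤ; +_; -[1+_]; ∣_∣; _⊖_)
import Data.Integer.Properties as ℤ
open import Data.Integer.Divisibility using (_∣_)
open import Data.Parity.Base as ℙ using (Parity; 0ℙ; 1ℙ)
import Data.Parity.Properties as ℙ
open import Data.Product using (_,_; _×_; ∃)
open import Data.Sum using (_⊎_; inj₁; inj₂)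
open import Data.Maybe using (Maybe; just; nothing)
open import Algebra.Bundles using (CommutativeRing)
open import Algebra.Solver.Ring.AlmostCommutativeRing
  using (fromCommutativeRing; _-Raw-AlmostCommutative⟶_)
open import Relation.Binary.Bundles using (Setoid)
import Relation.Binary.Reasoning.Setoid
open import Relation.Binary.PropositionalEquality
  using (_≡_; _≢_; ≢-sym; refl; sym; trans; cong; cong₂; subst; module ≡-Reasoning)
open import Relation.Nullary using (¬_; yes; no; contradiction)
open import Function using (_∘_)
open import Relation.Binary.Definitions using (tri<; tri≈; tri>)
open import Algebra.Properties.CommutativeSemigroup ℙ.+-commutativeSemigroup
  using (interchange; x∙yz≈y∙xz)

-- Power series over 𝔽₂

Series₂ : Set
Series₂ = ℕ → Parity

infix 4 _≈_ _≈[_]_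
infixl 6 _⊕_
infixl 7 _⋆_

_≈_ : Series₂ → Series₂ → Set
f ≈ g = ∀ n → f n ≡ g n

_≈[_]_ : Series₂ → ℕ → Series₂ → Set
f ≈[ d ] g = ∀ n → n ≤ d → f n ≡ g n

0ₛ 1ₛ : Series₂
0ₛ _ = 0ℙ
1ₛ zero    = 1ℙ
1ₛ (suc _) = 0ℙ

_⊕_ : Series₂ → Series₂ → Series₂
(f ⊕ g) n = f n ℙ.+ g n

tail : Series₂ → Series₂
tail f n = f (suc n)

_⋆_ : Series₂ → Series₂ → Series₂
(f ⋆ g) zero    = f 0 ℙ.* g 0
(f ⋆ g) (suc n) = (f 0 ℙ.* g (suc n)) ℙ.+ (tail f ⋆ g) n

scale : Parity → Series₂ → Series₂
scale c g n = c ℙ.* g n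

≈-refl : ∀ {f} → f ≈ f
≈-refl _ = refl

≈-sym : ∀ {f g} → f ≈ g → g ≈ f
≈-sym p n = sym (p n)

≈-trans : ∀ {f g h} → f ≈ g → g ≈ h → f ≈ h
≈-trans p q n = trans (p n) (q n)

≈-setoid : Setoid _ _
≈-setoid = record
  { Carrier       = Series₂
  ; _≈_           = _≈_
  ; isEquivalence = record { refl = ≈-refl ; sym = ≈-sym ; trans = ≈-trans }
  }

≡⇒≈ : ∀ {f g} → f ≡ g → f ≈ g
≡⇒≈ refl = ≈-refl

≈⇒≈[] : ∀ {d f g} → f ≈ g → f ≈[ d ] g
≈⇒≈[] p n _ = p n

≈[]-sym : ∀ {d f g} → f ≈[ d ] g → g ≈[ d ] f
≈[]-sym p n n≤d = sym (p n n≤d)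

≈[]-trans : ∀ {d f g h} → f ≈[ d ] g → g ≈[ d ] h → f ≈[ d ] h
≈[]-trans p q n n≤d = trans (p n n≤d) (q n n≤d)

≈[]-setoid : ℕ → Setoid _ _
≈[]-setoid d = record
  { Carrier       = Series₂
  ; _≈_           = _≈[ d ]_
  ; isEquivalence = record { refl = λ _ _ → refl ; sym = ≈[]-sym ; trans = ≈[]-trans }
  }

≈[]-weaken : ∀ {d e f g} → e ≤ d → f ≈[ d ] g → f ≈[ e ] g
≈[]-weaken e≤d p n n≤e = p n (ℕ.≤-trans n≤e e≤d)

⊕-cong : ∀ {f f′ g g′} → f ≈ f′ → g ≈ g′ → f ⊕ g ≈ f′ ⊕ g′
⊕-cong p q n = cong₂ ℙ._+_ (p n) (q n)

⊕-assoc : ∀ f g h → (f ⊕ g) ⊕ h ≈ f ⊕ (g ⊕ h)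
⊕-assoc f g h n = ℙ.+-assoc (f n) (g n) (h n)

⊕-comm : ∀ f g → f ⊕ g ≈ g ⊕ f
⊕-comm f g n = ℙ.+-comm (f n) (g n)

⊕-identityˡ : ∀ f → 0ₛ ⊕ f ≈ f
⊕-identityˡ f n = refl

⊕-identityʳ : ∀ f → f ⊕ 0ₛ ≈ f
⊕-identityʳ f n = ℙ.+-identityʳ (f n)

⊕-self : ∀ f → f ⊕ f ≈ 0ₛ
⊕-self f n = ℙ.p+p≡0ℙ (f n)

⋆-distribʳ : ∀ f f′ g → (f ⊕ f′) ⋆ g ≈ f ⋆ g ⊕ f′ ⋆ g
⋆-distribʳ f f′ g zero    = ℙ.*-distribʳ-+ (g 0) (f 0) (f′ 0)
⋆-distribʳ f f′ g (suc n) =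
  trans (cong₂ ℙ._+_ (ℙ.*-distribʳ-+ (g (suc n)) (f 0) (f′ 0)) (⋆-distribʳ (tail f) (tail f′) g n))
        (interchange (f 0 ℙ.* g (suc n)) (f′ 0 ℙ.* g (suc n)) ((tail f ⋆ g) n) ((tail f′ ⋆ g) n))

⋆-distribˡ : ∀ f g g′ → f ⋆ (g ⊕ g′) ≈ f ⋆ g ⊕ f ⋆ g′
⋆-distribˡ f g g′ zero    = ℙ.*-distribˡ-+ (f 0) (g 0) (g′ 0)
⋆-distribˡ f g g′ (suc n) =
  trans (cong₂ ℙ._+_ (ℙ.*-distribˡ-+ (f 0) (g (suc n)) (g′ (suc n))) (⋆-distribˡ (tail f) g g′ n))
        (interchange (f 0 ℙ.* g (suc n)) (f 0 ℙ.* g′ (suc n)) ((tail f ⋆ g) n) ((tail f ⋆ g′) n))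

⋆-zeroˡ : ∀ g → 0ₛ ⋆ g ≈ 0ₛ
⋆-zeroˡ g zero    = refl
⋆-zeroˡ g (suc n) = ⋆-zeroˡ g n

⋆-identityˡ : ∀ g → 1ₛ ⋆ g ≈ g
⋆-identityˡ g zero    = refl
⋆-identityˡ g (suc n) = trans (cong (g (suc n) ℙ.+_) (⋆-zeroˡ g n)) (ℙ.+-identityʳ _)

scale-⋆ : ∀ c f g → scale c f ⋆ g ≈ scale c (f ⋆ g)
scale-⋆ c f g zero    = ℙ.*-assoc c (f 0) (g 0)
scale-⋆ c f g (suc n) =
  trans (cong₂ ℙ._+_ (ℙ.*-assoc c (f 0) (g (suc n))) (scale-⋆ c (tail f) g n))
        (sym (ℙ.*-distribˡ-+ c (f 0 ℙ.* g (suc n)) ((tail f ⋆ g) n)))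

⋆-comm : ∀ f g → f ⋆ g ≈ g ⋆ f
⋆-comm f g zero          = ℙ.*-comm (f 0) (g 0)
⋆-comm f g (suc zero)    =
  trans (cong₂ ℙ._+_ (ℙ.*-comm (f 0) (g 1)) (ℙ.*-comm (f 1) (g 0))) (ℙ.+-comm (g 1 ℙ.* f 0) (g 0 ℙ.* f 1))
⋆-comm f g (suc (suc n)) = begin
  A ℙ.+ (tail f ⋆ g) (suc n)              ≡⟨ cong (A ℙ.+_) (⋆-comm (tail f) g (suc n)) ⟩
  A ℙ.+ (B ℙ.+ (tail g ⋆ tail f) n)       ≡⟨ cong (λ z → A ℙ.+ (B ℙ.+ z)) (⋆-comm (tail g) (tail f) n) ⟩
  A ℙ.+ (B ℙ.+ (tail f ⋆ tail g) n)       ≡⟨ x∙yz≈y∙xz A B _ ⟩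
  B ℙ.+ (A ℙ.+ (tail f ⋆ tail g) n)       ≡⟨ cong (B ℙ.+_) (⋆-comm f (tail g) (suc n)) ⟩
  B ℙ.+ (tail g ⋆ f) (suc n)              ∎
  where
  open ≡-Reasoning
  A = f 0 ℙ.* g (suc (suc n))
  B = g 0 ℙ.* f (suc (suc n))

⋆-zeroʳ : ∀ g → g ⋆ 0ₛ ≈ 0ₛ
⋆-zeroʳ g = ≈-trans (⋆-comm g 0ₛ) (⋆-zeroˡ g)

⋆-identityʳ : ∀ g → g ⋆ 1ₛ ≈ g
⋆-identityʳ g = ≈-trans (⋆-comm g 1ₛ) (⋆-identityˡ g)

⋆-assoc : ∀ f g h → (f ⋆ g) ⋆ h ≈ f ⋆ (g ⋆ h)
⋆-assoc f g h zero    = ℙ.*-assoc (f 0) (g 0) (h 0)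
⋆-assoc f g h (suc n) = begin
  ((f 0 ℙ.* g 0) ℙ.* h (suc n)) ℙ.+ (tail (f ⋆ g) ⋆ h) n
    ≡⟨ cong₂ ℙ._+_ (ℙ.*-assoc (f 0) (g 0) (h (suc n))) (⋆-distribʳ (scale (f 0) (tail g)) (tail f ⋆ g) h n) ⟩
  a ℙ.+ ((scale (f 0) (tail g) ⋆ h) n ℙ.+ ((tail f ⋆ g) ⋆ h) n)
    ≡⟨ cong (λ z → a ℙ.+ (z ℙ.+ ((tail f ⋆ g) ⋆ h) n)) (scale-⋆ (f 0) (tail g) h n) ⟩
  a ℙ.+ ((f 0 ℙ.* (tail g ⋆ h) n) ℙ.+ ((tail f ⋆ g) ⋆ h) n)
    ≡⟨ sym (ℙ.+-assoc a (f 0 ℙ.* (tail g ⋆ h) n) (((tail f ⋆ g) ⋆ h) n)) ⟩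
  (a ℙ.+ (f 0 ℙ.* (tail g ⋆ h) n)) ℙ.+ ((tail f ⋆ g) ⋆ h) n
    ≡⟨ cong₂ ℙ._+_ (sym (ℙ.*-distribˡ-+ (f 0) (g 0 ℙ.* h (suc n)) ((tail g ⋆ h) n))) (⋆-assoc (tail f) g h n) ⟩
  (f 0 ℙ.* (g ⋆ h) (suc n)) ℙ.+ (tail f ⋆ (g ⋆ h)) n
    ∎
  where
  open ≡-Reasoning
  a = f 0 ℙ.* (g 0 ℙ.* h (suc n))

⋆-coeff-cong : ∀ n {f f′ g g′} → f ≈[ n ] f′ → g ≈[ n ] g′ → (f ⋆ g) n ≡ (f′ ⋆ g′) n
⋆-coeff-cong zero    p q = cong₂ ℙ._*_ (p 0 z≤n) (q 0 z≤n)
⋆-coeff-cong (suc n) p q =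
  cong₂ ℙ._+_ (cong₂ ℙ._*_ (p 0 z≤n) (q (suc n) ℕ.≤-refl))
              (⋆-coeff-cong n (λ m m≤n → p (suc m) (s≤s m≤n)) (λ m m≤n → q m (ℕ.m≤n⇒m≤1+n m≤n)))

⋆-cong-≈[] : ∀ {d f f′ g g′} → f ≈[ d ] f′ → g ≈[ d ] g′ → f ⋆ g ≈[ d ] f′ ⋆ g′
⋆-cong-≈[] p q n n≤d =
  ⋆-coeff-cong n (λ m m≤n → p m (ℕ.≤-trans m≤n n≤d)) (λ m m≤n → q m (ℕ.≤-trans m≤n n≤d))

⋆-cong : ∀ {f f′ g g′} → f ≈ f′ → g ≈ g′ → f ⋆ g ≈ f′ ⋆ g′
⋆-cong p q n = ⋆-coeff-cong n (λ m _ → p m) (λ m _ → q m)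

series₂-commutativeRing : CommutativeRing _ _
series₂-commutativeRing = record
  { Carrier = Series₂ ; _≈_ = _≈_ ; _+_ = _⊕_ ; _*_ = _⋆_ ; -_ = λ f → f ; 0# = 0ₛ ; 1# = 1ₛ
  ; isCommutativeRing = record
    { isRing = record
      { +-isAbelianGroup = record
        { isGroup = record
          { isMonoid = record
            { isSemigroup = record
              { isMagma = record { isEquivalence = Setoid.isEquivalence ≈-setoid ; ∙-cong = ⊕-cong }
              ; assoc   = ⊕-assoc }
            ; identity = ⊕-identityˡ , ⊕-identityʳ }
          ; inverse = ⊕-self , ⊕-self
          ; ⁻¹-cong = λ p → p }
        ; comm = ⊕-comm }
      ; *-cong     = ⋆-cong
      ; *-assoc    = ⋆-assoc
      ; *-identity = ⋆-identityˡ , ⋆-identityʳ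
      ; distrib    = ⋆-distribˡ , λ g f f′ → ⋆-distribʳ f f′ g }
    ; *-comm = ⋆-comm } }

constant : Parity → Series₂
constant 0ℙ = 0ₛ
constant 1ℙ = 1ₛ

-- Parity coefficients (rather than ℕ or ℤ) let the solver use 1 + 1 = 0.
constant-homomorphism :
  CommutativeRing.rawRing ℙ.+-*-commutativeRing
    -Raw-AlmostCommutative⟶ fromCommutativeRing series₂-commutativeRing
constant-homomorphism = record
  { ⟦_⟧    = constant
  ; +-homo = +-homo
  ; *-homo = *-homo
  ; -‿homo = λ _ → ≈-refl
  ; 0-homo = ≈-refl
  ; 1-homo = ≈-refl
  }
  where
  +-homo : ∀ a b → constant (a ℙ.+ b) ≈ constant a ⊕ constant b
  +-homo 0ℙ b   n       = refl
  +-homo 1ℙ 0ℙ  n       = sym (⊕-identityʳ 1ₛ n)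
  +-homo 1ℙ 1ℙ  zero    = refl
  +-homo 1ℙ 1ℙ  (suc n) = refl
  *-homo : ∀ a b → constant (a ℙ.* b) ≈ constant a ⋆ constant b
  *-homo 0ℙ b = ≈-sym (⋆-zeroˡ (constant b))
  *-homo 1ℙ b = ≈-sym (⋆-identityˡ (constant b))

constant-≟ : ∀ a b → Maybe (constant a ≈ constant b)
constant-≟ 0ℙ 0ℙ = just ≈-refl
constant-≟ 1ℙ 1ℙ = just ≈-refl
constant-≟ _  _  = nothing

open import Algebra.Solver.Ring
  (CommutativeRing.rawRing ℙ.+-*-commutativeRing)
  (fromCommutativeRing series₂-commutativeRing) constant-homomorphism constant-≟
  using (solve; _:+_; _:*_; _:=_; con)

module ≈-Reasoning = Relation.Binary.Reasoning.Setoid ≈-setoid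
module ≈[]-Reasoning d = Relation.Binary.Reasoning.Setoid (≈[]-setoid d)

shift : Series₂ → Series₂
shift f zero    = 0ℙ
shift f (suc n) = f n

infix 9 q^_
q^_ : ℕ → Series₂
q^ zero  = 1ₛ
q^ suc k = shift (q^ k)

shift-⋆ : ∀ f g → shift f ⋆ g ≈ shift (f ⋆ g)
shift-⋆ f g zero    = refl
shift-⋆ f g (suc n) = refl

shift-cong : ∀ {f g} → f ≈ g → shift f ≈ shift g
shift-cong p zero    = refl
shift-cong p (suc n) = p n

q^-coeff-self : ∀ k → (q^ k) k ≡ 1ℙ
q^-coeff-self zero    = refl
q^-coeff-self (suc k) = q^-coeff-self k

q^-coeff-≢ : ∀ {k n} → n ≢ k → (q^ k) n ≡ 0ℙ
q^-coeff-≢ {zero}  {zero}  n≢k = contradiction refl n≢k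
q^-coeff-≢ {zero}  {suc n} _   = refl
q^-coeff-≢ {suc k} {zero}  _   = refl
q^-coeff-≢ {suc k} {suc n} n≢k = q^-coeff-≢ (n≢k ∘ cong suc)

q^-+ : ∀ a b → q^ a ⋆ q^ b ≈ q^ (a + b)
q^-+ zero    b = ⋆-identityˡ (q^ b)
q^-+ (suc a) b = ≈-trans (shift-⋆ (q^ a) (q^ b)) (shift-cong (q^-+ a b))

q^⋆-coeff-+ : ∀ k g i → (q^ k ⋆ g) (k + i) ≡ g i
q^⋆-coeff-+ zero    g i = ⋆-identityˡ g i
q^⋆-coeff-+ (suc k) g i = q^⋆-coeff-+ k g i

q^⋆-coeff-< : ∀ k g i → i < k → (q^ k ⋆ g) i ≡ 0ℙ
q^⋆-coeff-< (suc k) g zero    _         = refl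
q^⋆-coeff-< (suc k) g (suc i) (s≤s i<k) = q^⋆-coeff-< k g i i<k

q^⋆-coeff-≥ : ∀ k g i → k ≤ i → (q^ k ⋆ g) i ≡ g (i ∸ k)
q^⋆-coeff-≥ k g i k≤i =
  trans (cong (q^ k ⋆ g) (sym (ℕ.m+[n∸m]≡n k≤i))) (q^⋆-coeff-+ k g (i ∸ k))

q^⋆-cong-≈[] : ∀ k {d g h} → g ≈[ d ] h → q^ k ⋆ g ≈[ k + d ] q^ k ⋆ h
q^⋆-cong-≈[] zero    {g = g} {h} p n n≤d = trans (⋆-identityˡ g n) (trans (p n n≤d) (sym (⋆-identityˡ h n)))
q^⋆-cong-≈[] (suc k) p zero    _         = refl
q^⋆-cong-≈[] (suc k) p (suc n) (s≤s n≤) = q^⋆-cong-≈[] k p n n≤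

1+q^_ : ℕ → Series₂
1+q^ m = 1ₛ ⊕ q^ m

1+q^-≈[]-1ₛ : ∀ {m d} → d < m → 1+q^ m ≈[ d ] 1ₛ
1+q^-≈[]-1ₛ {m} d<m n n≤d =
  trans (cong (1ₛ n ℙ.+_) (q^-coeff-≢ (λ n≡m → ℕ.<-irrefl n≡m (ℕ.≤-<-trans n≤d d<m))))
        (ℙ.+-identityʳ (1ₛ n))

1+q^-cong : ∀ {a b} → a ≡ b → 1+q^ a ≈ 1+q^ b
1+q^-cong refl = ≈-refl

dilate : Series₂ → Series₂
dilate f zero          = f 0
dilate f (suc zero)    = 0ℙ
dilate f (suc (suc n)) = dilate (tail f) n

-- In characteristic 2 the cross terms f i f j + f j f i cancel.
frobenius : ∀ f → f ⋆ f ≈ dilate f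
frobenius f zero          = ℙ.*-idem (f 0)
frobenius f (suc zero)    =
  trans (cong (f 0 ℙ.* f 1 ℙ.+_) (ℙ.*-comm (f 1) (f 0))) (ℙ.p+p≡0ℙ (f 0 ℙ.* f 1))
frobenius f (suc (suc n)) = begin
  a ℙ.+ (tail f ⋆ f) (suc n)               ≡⟨ cong (a ℙ.+_) (⋆-comm (tail f) f (suc n)) ⟩
  a ℙ.+ (a ℙ.+ (tail f ⋆ tail f) n)        ≡⟨ sym (ℙ.+-assoc a a _) ⟩
  (a ℙ.+ a) ℙ.+ (tail f ⋆ tail f) n        ≡⟨ cong (ℙ._+ (tail f ⋆ tail f) n) (ℙ.p+p≡0ℙ a) ⟩
  (tail f ⋆ tail f) n                      ≡⟨ frobenius (tail f) n ⟩
  dilate (tail f) n                        ∎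
  where
  open ≡-Reasoning
  a = f 0 ℙ.* f (suc (suc n))

dilate-coeff-cong : ∀ n {f g} → f ≈[ n ] g → dilate f n ≡ dilate g n
dilate-coeff-cong zero          p = p 0 z≤n
dilate-coeff-cong (suc zero)    p = refl
dilate-coeff-cong (suc (suc n)) p =
  dilate-coeff-cong n (λ m m≤n → p (suc m) (s≤s (ℕ.m≤n⇒m≤1+n m≤n)))

dilate-cong-≈[] : ∀ {d f g} → f ≈[ d ] g → dilate f ≈[ d ] dilate g
dilate-cong-≈[] p n n≤d = dilate-coeff-cong n (λ m m≤n → p m (ℕ.≤-trans m≤n n≤d))

dilate-cong : ∀ {f g} → f ≈ g → dilate f ≈ dilate g
dilate-cong p n = dilate-coeff-cong n (λ m _ → p m)

dilate-coeff-double : ∀ f m → dilate f (m + m) ≡ f m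
dilate-coeff-double f zero    = refl
dilate-coeff-double f (suc m) rewrite ℕ.+-suc m m = dilate-coeff-double (tail f) m

dilate-⋆ : ∀ f g → dilate (f ⋆ g) ≈ dilate f ⋆ dilate g
dilate-⋆ f g = begin
  dilate (f ⋆ g)      ≈⟨ ≈-sym (frobenius (f ⋆ g)) ⟩
  (f ⋆ g) ⋆ (f ⋆ g)   ≈⟨ solve 2 (λ a b → (a :* b) :* (a :* b) := (a :* a) :* (b :* b)) ≈-refl f g ⟩
  (f ⋆ f) ⋆ (g ⋆ g)   ≈⟨ ⋆-cong (frobenius f) (frobenius g) ⟩
  dilate f ⋆ dilate g ∎
  where open ≈-Reasoning

dilate-1ₛ : dilate 1ₛ ≈ 1ₛ
dilate-1ₛ = ≈-trans (≈-sym (frobenius 1ₛ)) (⋆-identityˡ 1ₛ)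

dilate-1+q^ : ∀ m → dilate (1+q^ m) ≈ 1+q^ (m + m)
dilate-1+q^ m = begin
  dilate (1ₛ ⊕ q^ m)          ≈⟨ ≈-sym (frobenius (1+q^ m)) ⟩
  (1ₛ ⊕ q^ m) ⋆ (1ₛ ⊕ q^ m)   ≈⟨ solve 1 (λ a → (con 1ℙ :+ a) :* (con 1ℙ :+ a) := con 1ℙ :+ a :* a) ≈-refl (q^ m) ⟩
  1ₛ ⊕ q^ m ⋆ q^ m            ≈⟨ ⊕-cong {1ₛ} ≈-refl (q^-+ m m) ⟩
  1ₛ ⊕ q^ (m + m)             ∎
  where open ≈-Reasoning

≈[]-suc : ∀ {d f g} → f ≈[ d ] g → f (suc d) ≡ g (suc d) → f ≈[ suc d ] g
≈[]-suc {d} p top n n≤1+d with ℕ.m≤n⇒m<n∨m≡n n≤1+d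
... | inj₁ n<1+d = p n (ℕ.≤-pred n<1+d)
... | inj₂ refl  = top

unit-⋆-≈[]-0ₛ : ∀ d {u z} → u 0 ≡ 1ℙ → u ⋆ z ≈[ d ] 0ₛ → z ≈[ d ] 0ₛ
unit-⋆-≈[]-0ₛ zero    {u} {z} u₀ p zero z≤n = trans (cong (ℙ._* z 0) (sym u₀)) (p 0 z≤n)
unit-⋆-≈[]-0ₛ (suc d) {u} {z} u₀ p = ≈[]-suc below (begin
  z (suc d)                        ≡⟨ cong (ℙ._* z (suc d)) (sym u₀) ⟩
  u 0 ℙ.* z (suc d)                ≡⟨ sym (ℙ.+-identityʳ _) ⟩
  (u 0 ℙ.* z (suc d)) ℙ.+ 0ℙ       ≡⟨ cong (u 0 ℙ.* z (suc d) ℙ.+_) (sym tail-term) ⟩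
  (u ⋆ z) (suc d)                  ≡⟨ p (suc d) ℕ.≤-refl ⟩
  0ℙ                               ∎)
  where
  open ≡-Reasoning
  below : z ≈[ d ] 0ₛ
  below = unit-⋆-≈[]-0ₛ d u₀ (≈[]-weaken (ℕ.n≤1+n d) p)
  tail-term : (tail u ⋆ z) d ≡ 0ℙ
  tail-term = trans (⋆-coeff-cong d (λ _ _ → refl) below) (⋆-zeroʳ (tail u) d)

⋆-cancelˡ-≈[] : ∀ {d} u {f g} → u 0 ≡ 1ℙ → u ⋆ f ≈[ d ] u ⋆ g → f ≈[ d ] g
⋆-cancelˡ-≈[] {d} u {f} {g} u₀ p n n≤d = ℙ.+-cancelʳ-≡ (g n) (f n) (g n)
  (trans (f+g≈0 n n≤d) (sym (ℙ.p+p≡0ℙ (g n))))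
  where
  f+g≈0 : f ⊕ g ≈[ d ] 0ₛ
  f+g≈0 = unit-⋆-≈[]-0ₛ d u₀ λ m m≤d →
    trans (⋆-distribˡ u f g m) (trans (cong ((u ⋆ f) m ℙ.+_) (sym (p m m≤d))) (ℙ.p+p≡0ℙ ((u ⋆ f) m)))

∏ : (ℕ → Series₂) → ℕ → Series₂
∏ f zero    = 1ₛ
∏ f (suc n) = ∏ f n ⋆ f n

∏-cong : ∀ {f g} n → (∀ i → f i ≈ g i) → ∏ f n ≈ ∏ g n
∏-cong zero    p = ≈-refl
∏-cong (suc n) p = ⋆-cong (∏-cong n p) (p n)

∏-⋆ : ∀ f g n → ∏ (λ i → f i ⋆ g i) n ≈ ∏ f n ⋆ ∏ g n
∏-⋆ f g zero    = ≈-sym (⋆-identityˡ 1ₛ)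
∏-⋆ f g (suc n) = ≈-trans (⋆-cong (∏-⋆ f g n) ≈-refl)
  (solve 4 (λ a b c d → (a :* b) :* (c :* d) := (a :* c) :* (b :* d)) ≈-refl (∏ f n) (∏ g n) (f n) (g n))

∏-dilate : ∀ f n → dilate (∏ f n) ≈ ∏ (dilate ∘ f) n
∏-dilate f zero    = dilate-1ₛ
∏-dilate f (suc n) = ≈-trans (dilate-⋆ (∏ f n) (f n)) (⋆-cong (∏-dilate f n) ≈-refl)

∏-coeff-0 : ∀ f n → (∀ i → f i 0 ≡ 1ℙ) → ∏ f n 0 ≡ 1ℙ
∏-coeff-0 f zero    p = refl
∏-coeff-0 f (suc n) p rewrite ∏-coeff-0 f n p | p n = refl

∏-≈[]-stable : ∀ {d} f n k → (∀ i → n ≤ i → f i ≈[ d ] 1ₛ) → ∏ f (k + n) ≈[ d ] ∏ f n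
∏-≈[]-stable f n zero    p = λ _ _ → refl
∏-≈[]-stable f n (suc k) p =
  ≈[]-trans (⋆-cong-≈[] (∏-≈[]-stable f n k p) (p (k + n) (ℕ.m≤n+m n k)))
            (≈⇒≈[] (⋆-identityʳ (∏ f n)))

∏-*4 : ∀ g M → ∏ g (M * 4) ≈ ∏ (λ i → g (i * 4) ⋆ g (1 + i * 4) ⋆ g (2 + i * 4) ⋆ g (3 + i * 4)) M
∏-*4 g zero    = ≈-refl
∏-*4 g (suc M) = ≈-trans (⋆-cong (⋆-cong (⋆-cong (⋆-cong (∏-*4 g M) ≈-refl) ≈-refl) ≈-refl) ≈-refl)
  (solve 5 (λ p a b c d → p :* a :* b :* c :* d := p :* (a :* b :* c :* d)) ≈-refl
     _ (g (M * 4)) (g (1 + M * 4)) (g (2 + M * 4)) (g (3 + M * 4)))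

∏-*2 : ∀ g M → ∏ g (M * 2) ≈ ∏ (λ i → g (i * 2) ⋆ g (1 + i * 2)) M
∏-*2 g zero    = ≈-refl
∏-*2 g (suc M) = ≈-trans (⋆-cong (⋆-cong (∏-*2 g M) ≈-refl) ≈-refl)
  (solve 3 (λ p a b → p :* a :* b := p :* (a :* b)) ≈-refl _ (g (M * 2)) (g (1 + M * 2)))

∏-q^1 : ∀ n → ∏ (λ _ → q^ 1) n ≈ q^ n
∏-q^1 zero    = ≈-refl
∏-q^1 (suc n) = ≈-trans (⋆-cong (∏-q^1 n) ≈-refl) (≈-trans (q^-+ n 1) (≡⇒≈ (cong q^_ (ℕ.+-comm n 1))))

∑ : (ℕ → Series₂) → ℕ → Series₂
∑ h zero    = 0ₛ
∑ h (suc L) = h 0 ⊕ ∑ (h ∘ suc) L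

∑-cong : ∀ {h h′} L → (∀ l → h l ≈ h′ l) → ∑ h L ≈ ∑ h′ L
∑-cong zero    p = ≈-refl
∑-cong (suc L) p = ⊕-cong (p 0) (∑-cong L (p ∘ suc))

∑-cong-≈[] : ∀ {d h h′} L → (∀ l → l < L → h l ≈[ d ] h′ l) → ∑ h L ≈[ d ] ∑ h′ L
∑-cong-≈[] zero    p = λ _ _ → refl
∑-cong-≈[] (suc L) p n n≤d =
  cong₂ ℙ._+_ (p 0 (s≤s z≤n) n n≤d) (∑-cong-≈[] L (λ l l<L → p (suc l) (s≤s l<L)) n n≤d)

∑-⊕ : ∀ h h′ L → ∑ (λ l → h l ⊕ h′ l) L ≈ ∑ h L ⊕ ∑ h′ L
∑-⊕ h h′ zero    = ≈-sym (⊕-identityʳ 0ₛ)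
∑-⊕ h h′ (suc L) = ≈-trans (⊕-cong {h 0 ⊕ h′ 0} ≈-refl (∑-⊕ (h ∘ suc) (h′ ∘ suc) L))
  (λ n → interchange (h 0 n) (h′ 0 n) (∑ (h ∘ suc) L n) (∑ (h′ ∘ suc) L n))

∑-⋆ˡ : ∀ c h L → ∑ (λ l → c ⋆ h l) L ≈ c ⋆ ∑ h L
∑-⋆ˡ c h zero    = ≈-sym (⋆-zeroʳ c)
∑-⋆ˡ c h (suc L) = ≈-trans (⊕-cong {c ⋆ h 0} ≈-refl (∑-⋆ˡ c (h ∘ suc) L)) (≈-sym (⋆-distribˡ c (h 0) _))

∑-⋆ʳ : ∀ c h L → ∑ (λ l → h l ⋆ c) L ≈ ∑ h L ⋆ c
∑-⋆ʳ c h L = ≈-trans (∑-cong L (λ l → ⋆-comm (h l) c)) (≈-trans (∑-⋆ˡ c h L) (⋆-comm c _))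

∑-last : ∀ h L → ∑ h (suc L) ≈ ∑ h L ⊕ h L
∑-last h zero    = ≈-trans (⊕-identityʳ (h 0)) (≈-sym (⊕-identityˡ (h 0)))
∑-last h (suc L) = ≈-trans (⊕-cong {h 0} ≈-refl (∑-last (h ∘ suc) L)) (≈-sym (⊕-assoc (h 0) _ _))

∑-q^-coeff-∉ : ∀ L (f : ℕ → ℕ) D → (∀ l → l < L → f l ≢ D) → ∑ (q^_ ∘ f) L D ≡ 0ℙ
∑-q^-coeff-∉ zero    f D p = refl
∑-q^-coeff-∉ (suc L) f D p = cong₂ ℙ._+_ (q^-coeff-≢ (λ D≡f₀ → p 0 (s≤s z≤n) (sym D≡f₀)))
  (∑-q^-coeff-∉ L (f ∘ suc) D (λ l l<L → p (suc l) (s≤s l<L)))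

∑-q^-coeff-unique : ∀ L (f : ℕ → ℕ) D l₀ → l₀ < L → f l₀ ≡ D → (∀ l → f l ≡ D → l ≡ l₀) →
  ∑ (q^_ ∘ f) L D ≡ 1ℙ
∑-q^-coeff-unique (suc L) f D zero     _         f₀≡D unique = cong₂ ℙ._+_
  (trans (cong (q^ f 0) (sym f₀≡D)) (q^-coeff-self (f 0)))
  (∑-q^-coeff-∉ L (f ∘ suc) D (λ l _ fₗ≡D → ℕ.1+n≢0 (unique (suc l) fₗ≡D)))
∑-q^-coeff-unique (suc L) f D (suc l₀) (s≤s l₀<L) fₗ≡D unique = cong₂ ℙ._+_
  (q^-coeff-≢ (λ D≡f₀ → ℕ.0≢1+n (unique 0 (sym D≡f₀))))
  (∑-q^-coeff-unique L (f ∘ suc) D l₀ l₀<L fₗ≡D (λ l fₗ≡D′ → ℕ.suc-injective (unique (suc l) fₗ≡D′)))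

-- The polynomial Σ_{l<L} c_l zˡ, evaluated at z = q.
poly : (ℕ → Series₂) → ℕ → Series₂
poly c = ∑ (λ l → q^ l ⋆ c l)

poly-recurrence : ∀ (c c′ : ℕ → Series₂) α β L → c L ≈ 0ₛ →
  c′ 0 ≈ α ⋆ c 0 → (∀ l → c′ (suc l) ≈ α ⋆ c (suc l) ⊕ β ⋆ c l) →
  poly c′ (suc L) ≈ poly c L ⋆ (α ⊕ q^ 1 ⋆ β)
poly-recurrence c c′ α β L c[L]≈0 c′₀ c′ₛ = begin
  q^ 0 ⋆ c′ 0 ⊕ ∑ (λ l → q^ suc l ⋆ c′ (suc l)) L
    ≈⟨ ⊕-cong (⋆-cong ≈-refl c′₀) (∑-cong L term) ⟩
  q^ 0 ⋆ (α ⋆ c 0) ⊕ ∑ (λ l → α ⋆ (q^ suc l ⋆ c (suc l)) ⊕ (q^ 1 ⋆ β) ⋆ (q^ l ⋆ c l)) L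
    ≈⟨ ⊕-cong {q^ 0 ⋆ (α ⋆ c 0)} ≈-refl (≈-trans (∑-⊕ _ _ L) (⊕-cong (∑-⋆ˡ α _ L) (∑-⋆ˡ (q^ 1 ⋆ β) _ L))) ⟩
  q^ 0 ⋆ (α ⋆ c 0) ⊕ (α ⋆ S₁ ⊕ (q^ 1 ⋆ β) ⋆ poly c L)
    ≈⟨ solve 6 (λ x a c₀ s₁ xb s₀ → x :* (a :* c₀) :+ (a :* s₁ :+ xb :* s₀) := a :* (x :* c₀ :+ s₁) :+ xb :* s₀)
         ≈-refl (q^ 0) α (c 0) S₁ (q^ 1 ⋆ β) (poly c L) ⟩
  α ⋆ poly c (suc L) ⊕ (q^ 1 ⋆ β) ⋆ poly c L
    ≈⟨ ⊕-cong (⋆-cong ≈-refl (≈-trans (∑-last _ L) (≈-trans (⊕-cong {poly c L} ≈-refl top≈0) (⊕-identityʳ _)))) ≈-refl ⟩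
  α ⋆ poly c L ⊕ (q^ 1 ⋆ β) ⋆ poly c L
    ≈⟨ solve 3 (λ a xb p → a :* p :+ xb :* p := p :* (a :+ xb)) ≈-refl α (q^ 1 ⋆ β) (poly c L) ⟩
  poly c L ⋆ (α ⊕ q^ 1 ⋆ β) ∎
  where
  open ≈-Reasoning
  S₁ = ∑ (λ l → q^ suc l ⋆ c (suc l)) L
  top≈0 : q^ L ⋆ c L ≈ 0ₛ
  top≈0 = ≈-trans (⋆-cong ≈-refl c[L]≈0) (⋆-zeroʳ (q^ L))
  term : ∀ l → q^ suc l ⋆ c′ (suc l) ≈ α ⋆ (q^ suc l ⋆ c (suc l)) ⊕ (q^ 1 ⋆ β) ⋆ (q^ l ⋆ c l)
  term l = ≈-trans (⋆-cong (≈-sym (q^-+ 1 l)) (c′ₛ l)) (≈-trans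
    (solve 6 (λ x₁ xₗ a cₛ b cₗ → (x₁ :* xₗ) :* (a :* cₛ :+ b :* cₗ) := a :* ((x₁ :* xₗ) :* cₛ) :+ (x₁ :* b) :* (xₗ :* cₗ))
       ≈-refl (q^ 1) (q^ l) α (c (suc l)) β (c l))
    (⊕-cong (⋆-cong ≈-refl (⋆-cong (q^-+ 1 l) ≈-refl)) ≈-refl))

-- Reduction modulo 2

parityℤ : ℤ → Parity
parityℤ x = parity ∣ x ∣

parity-∸ : ∀ {m n} → n ≤ m → parity (m ∸ n) ≡ parity m ℙ.+ parity n
parity-∸ {m} {n} n≤m = ℙ.+-cancelʳ-≡ (parity n) _ _ (begin
  parity (m ∸ n) ℙ.+ parity n               ≡⟨ sym (ℙ.+-homo-+ (m ∸ n) n) ⟩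
  parity (m ∸ n + n)                        ≡⟨ cong parity (ℕ.m∸n+n≡m n≤m) ⟩
  parity m                                  ≡⟨ sym (ℙ.+-identityʳ (parity m)) ⟩
  parity m ℙ.+ 0ℙ                           ≡⟨ cong (parity m ℙ.+_) (sym (ℙ.p+p≡0ℙ (parity n))) ⟩
  parity m ℙ.+ (parity n ℙ.+ parity n)      ≡⟨ sym (ℙ.+-assoc (parity m) (parity n) (parity n)) ⟩
  (parity m ℙ.+ parity n) ℙ.+ parity n      ∎)
  where open ≡-Reasoning

parityℤ-⊖ : ∀ m n → parityℤ (m ⊖ n) ≡ parity m ℙ.+ parity n
parityℤ-⊖ m n with ℕ.≤-<-connex n m
... | inj₁ n≤m = trans (cong parityℤ (ℤ.⊖-≥ n≤m)) (parity-∸ n≤m)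
... | inj₂ m<n = begin
  parityℤ (m ⊖ n)             ≡⟨ cong parityℤ (ℤ.⊖-< m<n) ⟩
  parity ∣ ℤ.- + (n ∸ m) ∣    ≡⟨ cong parity (ℤ.∣-i∣≡∣i∣ (+ (n ∸ m))) ⟩
  parity (n ∸ m)              ≡⟨ parity-∸ (ℕ.<⇒≤ m<n) ⟩
  parity n ℙ.+ parity m       ≡⟨ ℙ.+-comm (parity n) (parity m) ⟩
  parity m ℙ.+ parity n       ∎
  where open ≡-Reasoning

parityℤ-+ : ∀ x y → parityℤ (x ℤ.+ y) ≡ parityℤ x ℙ.+ parityℤ y
parityℤ-+ (+ m)    (+ n)    = ℙ.+-homo-+ m n
parityℤ-+ (+ m)    -[1+ n ] = parityℤ-⊖ m (suc n)
parityℤ-+ -[1+ m ] (+ n)    = trans (parityℤ-⊖ n (suc m)) (ℙ.+-comm (parity n) (parity (suc m)))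
parityℤ-+ -[1+ m ] -[1+ n ] =
  trans (cong parity (sym (ℕ.+-suc (suc m) n))) (ℙ.+-homo-+ (suc m) (suc n))

parityℤ-* : ∀ x y → parityℤ (x ℤ.* y) ≡ parityℤ x ℙ.* parityℤ y
parityℤ-* x y = trans (cong parity (ℤ.abs-* x y)) (ℙ.*-homo-* ∣ x ∣ ∣ y ∣)

parityℤ-minus : ∀ x y → parityℤ (x ℤ.- y) ≡ parityℤ x ℙ.+ parityℤ y
parityℤ-minus x y = trans (parityℤ-+ x (ℤ.- y)) (cong (λ k → parityℤ x ℙ.+ parity k) (ℤ.∣-i∣≡∣i∣ y))

parity≡0ℙ⇒2∣ : ∀ n → parity n ≡ 0ℙ → 2 ℕ.∣ n
parity≡0ℙ⇒2∣ zero          _ = ℕ.divides 0 refl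
parity≡0ℙ⇒2∣ (suc (suc n)) p with ℕ.divides k n≡k*2 ← parity≡0ℙ⇒2∣ n p =
  ℕ.divides (suc k) (cong (suc ∘ suc) n≡k*2)

parityℤ≡0ℙ⇒2∣ : ∀ x → parityℤ x ≡ 0ℙ → + 2 ∣ x
parityℤ≡0ℙ⇒2∣ x = parity≡0ℙ⇒2∣ ∣ x ∣

parityℤ≡⇒2∣- : ∀ {x y} → parityℤ x ≡ parityℤ y → + 2 ∣ (x ℤ.- y)
parityℤ≡⇒2∣- {x} {y} eq = parityℤ≡0ℙ⇒2∣ (x ℤ.- y)
  (trans (parityℤ-minus x y) (trans (cong (ℙ._+ parityℤ y) eq) (ℙ.p+p≡0ℙ (parityℤ y))))

reduce : Series → Series₂
reduce f n = parityℤ (f n)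

convAux₂ : Series₂ → Series₂ → ℕ → ℕ → Parity
convAux₂ f g n zero    = f 0 ℙ.* g n
convAux₂ f g n (suc i) = (f (suc i) ℙ.* g (n ∸ suc i)) ℙ.+ convAux₂ f g n i

reduce-convAux : ∀ f g n i → parityℤ (convAux f g n i) ≡ convAux₂ (reduce f) (reduce g) n i
reduce-convAux f g n zero    = parityℤ-* (f 0) (g n)
reduce-convAux f g n (suc i) =
  trans (parityℤ-+ (f (suc i) ℤ.* g (n ∸ suc i)) (convAux f g n i))
        (cong₂ ℙ._+_ (parityℤ-* (f (suc i)) (g (n ∸ suc i))) (reduce-convAux f g n i))

convAux₂-suc : ∀ f g n i →
  convAux₂ f g (suc n) (suc i) ≡ (f 0 ℙ.* g (suc n)) ℙ.+ convAux₂ (tail f) g n i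
convAux₂-suc f g n zero    = ℙ.+-comm (f 1 ℙ.* g n) (f 0 ℙ.* g (suc n))
convAux₂-suc f g n (suc i) =
  trans (cong ((f (suc (suc i)) ℙ.* g (n ∸ suc i)) ℙ.+_) (convAux₂-suc f g n i))
        (x∙yz≈y∙xz (f (suc (suc i)) ℙ.* g (n ∸ suc i)) (f 0 ℙ.* g (suc n)) (convAux₂ (tail f) g n i))

convAux₂-⋆ : ∀ f g n → convAux₂ f g n n ≡ (f ⋆ g) n
convAux₂-⋆ f g zero    = refl
convAux₂-⋆ f g (suc n) =
  trans (convAux₂-suc f g n n) (cong ((f 0 ℙ.* g (suc n)) ℙ.+_) (convAux₂-⋆ (tail f) g n))

reduce-· : ∀ f g → reduce (f · g) ≈ reduce f ⋆ reduce g
reduce-· f g n = trans (reduce-convAux f g n n) (convAux₂-⋆ (reduce f) (reduce g) n)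

reduce-one : reduce one ≈ 1ₛ
reduce-one zero    = refl
reduce-one (suc n) = refl

reduce-oneMinusQ^ : ∀ k → reduce (oneMinusQ^ (suc k)) ≈ 1+q^ (suc k)
reduce-oneMinusQ^ k zero    = refl
reduce-oneMinusQ^ k (suc j) with suc j ≟ suc k
... | yes refl = sym (q^-coeff-self (suc j))
... | no  j≢k  = sym (q^-coeff-≢ j≢k)

infixr 8 _^_
_^_ : Series₂ → ℕ → Series₂
f ^ zero  = 1ₛ
f ^ suc k = f ^ k ⋆ f

^-cong-≈[] : ∀ {d f g} k → f ≈[ d ] g → f ^ k ≈[ d ] g ^ k
^-cong-≈[] zero    p = λ _ _ → refl
^-cong-≈[] (suc k) p = ⋆-cong-≈[] (^-cong-≈[] k p) p

reduce-^ : ∀ f k → reduce (f ^ˢ k) ≈ reduce f ^ k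
reduce-^ f zero    = reduce-one
reduce-^ f (suc k) = ≈-trans (reduce-· (f ^ˢ k) f) (⋆-cong (reduce-^ f k) ≈-refl)

euler₂ : ℕ → Series₂
euler₂ = ∏ (λ i → 1+q^ suc i)

euler₂-coeff-0 : ∀ M → euler₂ M 0 ≡ 1ℙ
euler₂-coeff-0 M = ∏-coeff-0 (λ i → 1+q^ suc i) M (λ i → refl)

euler₂-≈[] : ∀ {d M} → d < M → euler₂ M ≈[ d ] euler₂ (suc d)
euler₂-≈[] {d} {M} d<M = subst (λ K → euler₂ K ≈[ d ] euler₂ (suc d)) (ℕ.m∸n+n≡m d<M)
  (∏-≈[]-stable (λ i → 1+q^ suc i) (suc d) (M ∸ suc d) (λ i d<i → 1+q^-≈[]-1ₛ (s≤s (ℕ.<⇒≤ d<i))))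

reduce-eulerPartial : ∀ N → reduce (eulerPartial N) ≈ euler₂ N
reduce-eulerPartial zero    = reduce-one
reduce-eulerPartial (suc N) =
  ≈-trans (reduce-· (eulerPartial N) (oneMinusQ^ (suc N)))
          (⋆-cong (reduce-eulerPartial N) (reduce-oneMinusQ^ N))

parityℤ-τ : ∀ k n → parityℤ (τ k (suc n)) ≡ (euler₂ (suc n) ^ k) n
parityℤ-τ k n =
  trans (reduce-^ (eulerPartial (suc n)) k n)
        (^-cong-≈[] k (≈⇒≈[] (reduce-eulerPartial (suc n))) n ℕ.≤-refl)

-- Partitions with no part divisible by t

≤?-shift : ∀ {m n} x → m ≤ n → ⌊ m + x ≤? n ⌋ ≡ ⌊ x ≤? n ∸ m ⌋
≤?-shift {m} {n} x m≤n with m + x ≤? n | x ≤? n ∸ m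
... | yes _   | yes _ = refl
... | no  _   | no  _ = refl
... | yes m+x≤n | no x≰n∸m =
  contradiction (ℕ.m+n≤o⇒m≤o∸n x (subst (_≤ n) (ℕ.+-comm m x) m+x≤n)) x≰n∸m
... | no m+x≰n  | yes x≤n∸m =
  contradiction (subst (_≤ n) (ℕ.+-comm x m) (ℕ.m≤o∸n⇒m+n≤o x m≤n x≤n∸m)) m+x≰n

-- sumMult t b n (suc c) unfolds to sumMult t b n c + summand t b n (suc c).
summand : ℕ → ℕ → ℕ → ℕ → ℕ
summand t b n c =
  if ⌊ c * suc b ≤? n ⌋ ∧ not (divisibleBy t (suc b)) then P t b (n ∸ c * suc b) else 0

summand-divisible : ∀ {t b} n c → divisibleBy t (suc b) ≡ true → summand t b n c ≡ 0
summand-divisible {t} {b} n c t∣b+1 rewrite t∣b+1 | 𝔹.∧-zeroʳ ⌊ c * suc b ≤? n ⌋ = refl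

summand-> : ∀ t b {n} c → n < c * suc b → summand t b n c ≡ 0
summand-> t b {n} c n<c[b+1] with c * suc b ≤? n
... | yes c[b+1]≤n = contradiction c[b+1]≤n (ℕ.<⇒≱ n<c[b+1])
... | no  _        = refl

summand-shift : ∀ {t b} n c → divisibleBy t (suc b) ≡ false → suc b ≤ n →
                summand t b n (suc c) ≡ summand t b (n ∸ suc b) c
summand-shift {t} {b} n c t∤b+1 b<n rewrite t∤b+1
  | 𝔹.∧-identityʳ ⌊ suc c * suc b ≤? n ⌋ | 𝔹.∧-identityʳ ⌊ c * suc b ≤? n ∸ suc b ⌋
  | ≤?-shift (c * suc b) b<n | ℕ.∸-+-assoc n (suc b) (c * suc b) = refl

summand-0 : ∀ {t b} n → divisibleBy t (suc b) ≡ false → summand t b n 0 ≡ P t b n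
summand-0 {t} {b} n t∤b+1
  rewrite t∤b+1 | 𝔹.∧-identityʳ ⌊ 0 ≤? n ⌋ | dec-true (0 ≤? n) z≤n = refl

sumMult-vanishing : ∀ {t b n} → (∀ c → summand t b n (suc c) ≡ 0) → ∀ c → sumMult t b n c ≡ P t b n
sumMult-vanishing p zero    = refl
sumMult-vanishing p (suc c) = trans (cong₂ _+_ (sumMult-vanishing p c) (p c)) (ℕ.+-identityʳ _)

sumMult-shift : ∀ {t b} n c → divisibleBy t (suc b) ≡ false → suc b ≤ n →
                sumMult t b n (suc c) ≡ P t b n + sumMult t b (n ∸ suc b) c
sumMult-shift {t} {b} n zero t∤b+1 b<n =
  cong (λ z → P t b n + z) (trans (summand-shift {t} {b} n 0 t∤b+1 b<n) (summand-0 {t} {b} (n ∸ suc b) t∤b+1))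
sumMult-shift {t} {b} n (suc c) t∤b+1 b<n = trans
  (cong₂ _+_ (sumMult-shift n c t∤b+1 b<n) (summand-shift {t} {b} n (suc c) t∤b+1 b<n))
  (ℕ.+-assoc (P t b n) (sumMult t b (n ∸ suc b) c) (summand t b (n ∸ suc b) (suc c)))

sumMult-stable : ∀ t b k j → sumMult t b k (j + k) ≡ sumMult t b k k
sumMult-stable t b k zero    = refl
sumMult-stable t b k (suc j) = trans
  (cong (λ z → sumMult t b k (j + k) + z)
        (summand-> t b (suc (j + k)) (ℕ.≤-trans (s≤s (ℕ.m≤n+m k j)) (ℕ.m≤m*n _ (suc b)))))
  (trans (ℕ.+-identityʳ _) (sumMult-stable t b k j))

P-divisible : ∀ t b n → divisibleBy t (suc b) ≡ true → P t (suc b) n ≡ P t b n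
P-divisible t b n t∣b+1 = sumMult-vanishing (λ c → summand-divisible n (suc c) t∣b+1) n

P-< : ∀ t b n → n < suc b → P t (suc b) n ≡ P t b n
P-< t b n n≤b = sumMult-vanishing
  (λ c → summand-> t b (suc c) (ℕ.<-≤-trans n≤b (ℕ.m≤n*m (suc b) (suc c)))) n

P-≥ : ∀ t b n → divisibleBy t (suc b) ≡ false → suc b ≤ n →
      P t (suc b) n ≡ P t b n + P t (suc b) (n ∸ suc b)
P-≥ t b (suc n) t∤b+1 b<n = trans (sumMult-shift (suc n) n t∤b+1 b<n) (cong (λ z → P t b (suc n) + z) (begin
  sumMult t b (n ∸ b) n                      ≡⟨ cong (sumMult t b (n ∸ b)) (sym (ℕ.m∸n+n≡m (ℕ.m∸n≤m n b))) ⟩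
  sumMult t b (n ∸ b) (n ∸ (n ∸ b) + (n ∸ b)) ≡⟨ sumMult-stable t b (n ∸ b) (n ∸ (n ∸ b)) ⟩
  sumMult t b (n ∸ b) (n ∸ b)                ∎))
  where open ≡-Reasoning

P-large : ∀ t k n → P t (k + n) n ≡ R t n
P-large t zero    n = refl
P-large t (suc k) n = trans (P-< t (k + n) n (s≤s (ℕ.m≤n+m n k))) (P-large t k n)

partitions₂ : ℕ → ℕ → Series₂
partitions₂ t b n = parity (P t b n)

restrictedFactor divisibleFactor : ℕ → ℕ → Series₂
restrictedFactor t m = if divisibleBy t m then 1ₛ else 1+q^ m
divisibleFactor  t m = if divisibleBy t m then 1+q^ m else 1ₛ

restrictedEuler divisibleEuler : ℕ → ℕ → Series₂
restrictedEuler t = ∏ (λ i → restrictedFactor t (suc i))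
divisibleEuler  t = ∏ (λ i → divisibleFactor t (suc i))

partitions₂-step : ∀ t b → partitions₂ t (suc b) ⋆ restrictedFactor t (suc b) ≈ partitions₂ t b
partitions₂-step t b n with divisibleBy t (suc b) in t∣b+1?
... | true  = trans (⋆-identityʳ (partitions₂ t (suc b)) n) (cong parity (P-divisible t b n t∣b+1?))
... | false = begin
  (p′ ⋆ (1ₛ ⊕ q^ suc b)) n            ≡⟨ ⋆-distribˡ p′ 1ₛ (q^ suc b) n ⟩
  (p′ ⋆ 1ₛ) n ℙ.+ (p′ ⋆ q^ suc b) n   ≡⟨ cong₂ ℙ._+_ (⋆-identityʳ p′ n) (⋆-comm p′ (q^ suc b) n) ⟩
  p′ n ℙ.+ (q^ suc b ⋆ p′) n          ≡⟨ removeLargest ⟩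
  parity (P t b n)                   ∎
  where
  open ≡-Reasoning
  p′ = partitions₂ t (suc b)
  removeLargest : p′ n ℙ.+ (q^ suc b ⋆ p′) n ≡ parity (P t b n)
  removeLargest with suc b ≤? n
  ... | yes b<n = begin
    parity (P t (suc b) n) ℙ.+ (q^ suc b ⋆ p′) n
      ≡⟨ cong₂ ℙ._+_ (cong parity (P-≥ t b n t∣b+1? b<n)) (q^⋆-coeff-≥ (suc b) p′ n b<n) ⟩
    parity (P t b n + x) ℙ.+ parity x
      ≡⟨ cong (ℙ._+ parity x) (ℙ.+-homo-+ (P t b n) x) ⟩
    (parity (P t b n) ℙ.+ parity x) ℙ.+ parity x
      ≡⟨ ℙ.+-assoc (parity (P t b n)) (parity x) (parity x) ⟩
    parity (P t b n) ℙ.+ (parity x ℙ.+ parity x)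
      ≡⟨ cong (parity (P t b n) ℙ.+_) (ℙ.p+p≡0ℙ (parity x)) ⟩
    parity (P t b n) ℙ.+ 0ℙ
      ≡⟨ ℙ.+-identityʳ (parity (P t b n)) ⟩
    parity (P t b n) ∎
    where x = P t (suc b) (n ∸ suc b)
  ... | no b≮n = trans (cong₂ ℙ._+_ (cong parity (P-< t b n n≤b)) (q^⋆-coeff-< (suc b) p′ n n≤b))
                       (ℙ.+-identityʳ (parity (P t b n)))
    where n≤b = ℕ.≰⇒> b≮n

partitions₂-0 : ∀ t → partitions₂ t 0 ≈ 1ₛ
partitions₂-0 t zero    = refl
partitions₂-0 t (suc n) = refl

partitions₂-⋆-restrictedEuler : ∀ t b → partitions₂ t b ⋆ restrictedEuler t b ≈ 1ₛ
partitions₂-⋆-restrictedEuler t zero    = ≈-trans (⋆-identityʳ (partitions₂ t 0)) (partitions₂-0 t)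
partitions₂-⋆-restrictedEuler t (suc b) = begin
  p′ ⋆ (restrictedEuler t b ⋆ f)
    ≈⟨ solve 3 (λ p a f → p :* (a :* f) := (p :* f) :* a) ≈-refl p′ (restrictedEuler t b) f ⟩
  (p′ ⋆ f) ⋆ restrictedEuler t b   ≈⟨ ⋆-cong (partitions₂-step t b) ≈-refl ⟩
  partitions₂ t b ⋆ restrictedEuler t b ≈⟨ partitions₂-⋆-restrictedEuler t b ⟩
  1ₛ                               ∎
  where
  open ≈-Reasoning
  p′ = partitions₂ t (suc b)
  f  = restrictedFactor t (suc b)

restrictedFactor-⋆-divisibleFactor : ∀ t m → restrictedFactor t m ⋆ divisibleFactor t m ≈ 1+q^ m
restrictedFactor-⋆-divisibleFactor t m with divisibleBy t m
... | true  = ⋆-identityˡ (1+q^ m)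
... | false = ⋆-identityʳ (1+q^ m)

restrictedEuler-⋆-divisibleEuler : ∀ t b → restrictedEuler t b ⋆ divisibleEuler t b ≈ euler₂ b
restrictedEuler-⋆-divisibleEuler t b =
  ≈-trans (≈-sym (∏-⋆ (restrictedFactor t ∘ suc) (divisibleFactor t ∘ suc) b))
          (∏-cong b (λ i → restrictedFactor-⋆-divisibleFactor t (suc i)))

-- Part (a)

divisibleBy-periodic : ∀ t j M → divisibleBy (suc t) (j + M * suc t) ≡ divisibleBy (suc t) j
divisibleBy-periodic t j M = cong (λ r → ⌊ r ≟ 0 ⌋) ([m+kn]%n≡m%n j M (suc t))

divisibleFactor-periodic : ∀ t j M →
  divisibleFactor (suc t) (j + M * suc t) ≡ (if divisibleBy (suc t) j then 1+q^ (j + M * suc t) else 1ₛ)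
divisibleFactor-periodic t j M =
  cong (λ b → if b then 1+q^ (j + M * suc t) else 1ₛ) (divisibleBy-periodic t j M)

divisibleEuler-8 : ∀ M → divisibleEuler 8 (M * 8) ≈ ∏ (λ i → 1+q^ (8 + i * 8)) M
divisibleEuler-8 zero    = ≈-refl
divisibleEuler-8 (suc M) = begin
  divisibleEuler 8 (M * 8) ⋆ d 1 ⋆ d 2 ⋆ d 3 ⋆ d 4 ⋆ d 5 ⋆ d 6 ⋆ d 7 ⋆ d 8
    ≈⟨ ⋆-cong (⋆-cong (⋆-cong (⋆-cong (⋆-cong (⋆-cong (⋆-cong (⋆-cong (divisibleEuler-8 M)
         (≡⇒≈ (divisibleFactor-periodic 7 1 M))) (≡⇒≈ (divisibleFactor-periodic 7 2 M)))
         (≡⇒≈ (divisibleFactor-periodic 7 3 M))) (≡⇒≈ (divisibleFactor-periodic 7 4 M)))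
         (≡⇒≈ (divisibleFactor-periodic 7 5 M))) (≡⇒≈ (divisibleFactor-periodic 7 6 M)))
         (≡⇒≈ (divisibleFactor-periodic 7 7 M))) (≡⇒≈ (divisibleFactor-periodic 7 8 M)) ⟩
  Q ⋆ 1ₛ ⋆ 1ₛ ⋆ 1ₛ ⋆ 1ₛ ⋆ 1ₛ ⋆ 1ₛ ⋆ 1ₛ ⋆ 1+q^ (8 + M * 8)
    ≈⟨ solve 2 (λ q f → q :* con 1ℙ :* con 1ℙ :* con 1ℙ :* con 1ℙ :* con 1ℙ :* con 1ℙ :* con 1ℙ :* f := q :* f)
         ≈-refl Q (1+q^ (8 + M * 8)) ⟩
  Q ⋆ 1+q^ (8 + M * 8) ∎
  where
  open ≈-Reasoning
  d : ℕ → Series₂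
  d j = divisibleFactor 8 (j + M * 8)
  Q = ∏ (λ i → 1+q^ (8 + i * 8)) M

dilate-∏-1+q^ : ∀ (f : ℕ → ℕ) M → dilate (∏ (λ i → 1+q^ f i) M) ≈ ∏ (λ i → 1+q^ (f i + f i)) M
dilate-∏-1+q^ f M = ≈-trans (∏-dilate (λ i → 1+q^ f i) M) (∏-cong M (λ i → dilate-1+q^ (f i)))

dilate³-euler₂ : ∀ M → dilate (dilate (dilate (euler₂ M))) ≈ ∏ (λ i → 1+q^ (8 + i * 8)) M
dilate³-euler₂ M = begin
  dilate (dilate (dilate (euler₂ M)))
    ≈⟨ dilate-cong (dilate-cong (dilate-∏-1+q^ suc M)) ⟩
  dilate (dilate (∏ (λ i → 1+q^ (suc i + suc i)) M))
    ≈⟨ dilate-cong (dilate-∏-1+q^ (λ i → suc i + suc i) M) ⟩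
  dilate (∏ (λ i → 1+q^ ((suc i + suc i) + (suc i + suc i))) M)
    ≈⟨ dilate-∏-1+q^ (λ i → (suc i + suc i) + (suc i + suc i)) M ⟩
  ∏ (λ i → 1+q^ (((suc i + suc i) + (suc i + suc i)) + ((suc i + suc i) + (suc i + suc i)))) M
    ≈⟨ ∏-cong M (λ i → ≡⇒≈ (cong 1+q^_ (8[i+1] i))) ⟩
  ∏ (λ i → 1+q^ (8 + i * 8)) M ∎
  where
  open ≈-Reasoning
  8[i+1] : ∀ i → ((suc i + suc i) + (suc i + suc i)) + ((suc i + suc i) + (suc i + suc i)) ≡ 8 + i * 8
  8[i+1] = solve-∀

dilate⁴ : Series₂ → Series₂
dilate⁴ f = dilate (dilate (dilate (dilate f)))

^16≈dilate⁴ : ∀ f → f ^ 16 ≈ dilate⁴ f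
^16≈dilate⁴ f = begin
  f ^ 16
    ≈⟨ solve 1 (λ x → con 1ℙ :* x :* x :* x :* x :* x :* x :* x :* x :* x :* x :* x :* x :* x :* x :* x :* x
                      := sq (sq (sq (sq x)))) ≈-refl f ⟩
  f⁸ ⋆ f⁸                      ≈⟨ frobenius f⁸ ⟩
  dilate f⁸                    ≈⟨ dilate-cong (frobenius (f² ⋆ f²)) ⟩
  dilate (dilate (f² ⋆ f²))    ≈⟨ dilate-cong (dilate-cong (frobenius f²)) ⟩
  dilate (dilate (dilate f²))  ≈⟨ dilate-cong (dilate-cong (dilate-cong (frobenius f))) ⟩
  dilate⁴ f                    ∎
  where
  open ≈-Reasoning
  sq = λ x → x :* x
  f² = f ⋆ f
  f⁸ = (f² ⋆ f²) ⋆ (f² ⋆ f²)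

euler₂⋆partitions₂≈dilate³ : ∀ M →
  euler₂ (M * 8) ⋆ partitions₂ 8 (M * 8) ≈ dilate (dilate (dilate (euler₂ M)))
euler₂⋆partitions₂≈dilate³ M = begin
  U ⋆ Pp               ≈⟨ ⋆-cong U≈A⋆C ≈-refl ⟩
  (A ⋆ C) ⋆ Pp         ≈⟨ solve 3 (λ p a c → (a :* c) :* p := (p :* a) :* c) ≈-refl Pp A C ⟩
  (Pp ⋆ A) ⋆ C         ≈⟨ ⋆-cong (partitions₂-⋆-restrictedEuler 8 (M * 8)) ≈-refl ⟩
  1ₛ ⋆ C               ≈⟨ ⋆-identityˡ C ⟩
  C                    ∎
  where
  open ≈-Reasoning
  U = euler₂ (M * 8)
  Pp = partitions₂ 8 (M * 8)
  A = restrictedEuler 8 (M * 8)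
  C = dilate (dilate (dilate (euler₂ M)))
  U≈A⋆C : U ≈ A ⋆ C
  U≈A⋆C = ≈-trans (≈-sym (restrictedEuler-⋆-divisibleEuler 8 (M * 8)))
                  (⋆-cong ≈-refl (≈-trans (divisibleEuler-8 M) (≈-sym (dilate³-euler₂ M))))

euler₂^14≈[]dilate-partitions₂ : ∀ {d M} → d < M →
  euler₂ (M * 8) ^ 14 ≈[ d ] dilate (partitions₂ 8 (M * 8))
euler₂^14≈[]dilate-partitions₂ {d} {M} d<M =
  ⋆-cancelˡ-≈[] (dilate U) (euler₂-coeff-0 (M * 8)) (begin
    dilate U ⋆ U ^ 14         ≈⟨ ≈⇒≈[] (≈-trans (⋆-comm (dilate U) (U ^ 14)) (⋆-cong ≈-refl (≈-sym (frobenius U)))) ⟩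
    U ^ 14 ⋆ (U ⋆ U)          ≈⟨ ≈⇒≈[] (≈-sym (⋆-assoc (U ^ 14) U U)) ⟩
    U ^ 16                    ≈⟨ ≈⇒≈[] (^16≈dilate⁴ U) ⟩
    dilate⁴ U                 ≈⟨ dilate-cong-≈[] (dilate-cong-≈[] (dilate-cong-≈[] (dilate-cong-≈[] U≈[]E))) ⟩
    dilate⁴ (euler₂ M)        ≈⟨ ≈⇒≈[] (dilate-cong (≈-sym (euler₂⋆partitions₂≈dilate³ M))) ⟩
    dilate (U ⋆ Pp)           ≈⟨ ≈⇒≈[] (dilate-⋆ U Pp) ⟩
    dilate U ⋆ dilate Pp      ∎)
  where
  open ≈[]-Reasoning d
  U = euler₂ (M * 8)
  Pp = partitions₂ 8 (M * 8)
  U≈[]E : U ≈[ d ] euler₂ M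
  U≈[]E = ≈[]-trans (euler₂-≈[] (ℕ.<-≤-trans d<M (ℕ.m≤m*n M 8))) (≈[]-sym (euler₂-≈[] d<M))

τ14-parity : ∀ m → parityℤ (τ 14 (suc (m + m))) ≡ parity (R 8 m)
τ14-parity m = begin
  parityℤ (τ 14 (suc (m + m)))         ≡⟨ parityℤ-τ 14 (m + m) ⟩
  (euler₂ M ^ 14) (m + m)              ≡⟨ ^-cong-≈[] 14 (≈[]-sym (euler₂-≈[] 2m<8M)) (m + m) ℕ.≤-refl ⟩
  (euler₂ (M * 8) ^ 14) (m + m)        ≡⟨ euler₂^14≈[]dilate-partitions₂ ℕ.≤-refl (m + m) ℕ.≤-refl ⟩
  dilate (partitions₂ 8 (M * 8)) (m + m) ≡⟨ dilate-coeff-double (partitions₂ 8 (M * 8)) m ⟩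
  parity (P 8 (M * 8) m)               ≡⟨ cong (λ b → parity (P 8 b m)) (sym (ℕ.m∸n+n≡m m≤8M)) ⟩
  parity (P 8 (M * 8 ∸ m + m) m)       ≡⟨ cong parity (P-large 8 (M * 8 ∸ m) m) ⟩
  parity (R 8 m)                       ∎
  where
  open ≡-Reasoning
  M = suc (m + m)
  2m<8M : m + m < M * 8
  2m<8M = ℕ.m≤m*n M 8
  m≤8M : m ≤ M * 8
  m≤8M = ℕ.≤-trans (ℕ.m≤m+n m m) (ℕ.<⇒≤ 2m<8M)

-- Triangular numbers

tri : ℕ → ℕ
tri zero    = 0
tri (suc k) = tri k + suc k

-- tri-dist b l = (l - b)(l - b - 1)/2, the integer l - b being read off from the recursion.
tri-dist : ℕ → ℕ → ℕ
tri-dist b       zero    = tri b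
tri-dist zero    (suc l) = tri l
tri-dist (suc b) (suc l) = tri-dist b l

tri-dist-suc : ∀ b l → tri-dist b l + suc l ≡ suc b + tri-dist b (suc l)
tri-dist-suc zero    zero    = refl
tri-dist-suc zero    (suc l) = lemma (tri l) l
  where
  lemma : ∀ x l → x + suc (suc l) ≡ 1 + (x + suc l)
  lemma = solve-∀
tri-dist-suc (suc b) zero    = lemma (tri b) b
  where
  lemma : ∀ x b → (x + suc b) + 1 ≡ suc (suc b) + x
  lemma = solve-∀
tri-dist-suc (suc b) (suc l) = trans (lemma (tri-dist b l) l) (cong suc (tri-dist-suc b l))
  where
  lemma : ∀ x l → x + suc (suc l) ≡ suc (x + suc l)
  lemma = solve-∀

tri-dist-suc′ : ∀ a b l → l ≤ a + b → tri-dist b (suc l) + (a + b ∸ l) ≡ a + tri-dist b l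
tri-dist-suc′ a b l l≤a+b = ℕ.+-cancelʳ-≡ (suc l) _ _ (begin
  (t′ + (a + b ∸ l)) + suc l ≡⟨ lemma₁ t′ (a + b ∸ l) l ⟩
  t′ + suc (a + b ∸ l + l)   ≡⟨ cong (λ z → t′ + suc z) (ℕ.m∸n+n≡m l≤a+b) ⟩
  t′ + suc (a + b)           ≡⟨ lemma₂ t′ a b ⟩
  a + (suc b + t′)           ≡⟨ cong (_+_ a) (sym (tri-dist-suc b l)) ⟩
  a + (tri-dist b l + suc l) ≡⟨ sym (ℕ.+-assoc a (tri-dist b l) (suc l)) ⟩
  a + tri-dist b l + suc l   ∎)
  where
  open ≡-Reasoning
  t′ = tri-dist b (suc l)
  lemma₁ : ∀ x y l → (x + y) + suc l ≡ x + suc (y + l)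
  lemma₁ = solve-∀
  lemma₂ : ∀ x a b → x + suc (a + b) ≡ a + (suc b + x)
  lemma₂ = solve-∀

tri-double : ∀ j → 2 * tri j ≡ j * suc j
tri-double zero    = refl
tri-double (suc j) = trans (lemma (tri j) j) (trans (cong (_+ 2 * suc j) (tri-double j)) (lemma′ j))
  where
  lemma : ∀ x j → 2 * (x + suc j) ≡ 2 * x + 2 * suc j
  lemma = solve-∀
  lemma′ : ∀ j → j * suc j + 2 * suc j ≡ suc j * suc (suc j)
  lemma′ = solve-∀

n≤tri : ∀ j → j ≤ tri j
n≤tri zero    = z≤n
n≤tri (suc j) = ℕ.m≤n+m (suc j) (tri j)

tri-< : ∀ {a b} → a < b → tri a < tri b
tri-< {a} {suc b} (s≤s a≤b) with ℕ.m≤n⇒m<n∨m≡n a≤b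
... | inj₁ a<b  = ℕ.<-≤-trans (tri-< a<b) (ℕ.m≤m+n (tri b) (suc b))
... | inj₂ refl = ℕ.m<m+n (tri a) (s≤s z≤n)

tri-injective : ∀ {a b} → tri a ≡ tri b → a ≡ b
tri-injective {a} {b} eq with ℕ.<-cmp a b
... | tri< a<b _ _ = contradiction eq (ℕ.<⇒≢ (tri-< a<b))
... | tri≈ _ a≡b _ = a≡b
... | tri> _ _ b<a = contradiction (sym eq) (ℕ.<⇒≢ (tri-< b<a))

tri-dist-below : ∀ k l → tri-dist (k + l) l ≡ tri k
tri-dist-below k zero    = cong tri (ℕ.+-identityʳ k)
tri-dist-below k (suc l) = trans (cong (λ b → tri-dist b (suc l)) (ℕ.+-suc k l)) (tri-dist-below k l)

tri-dist-above : ∀ n r → tri-dist n (suc (r + n)) ≡ tri r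
tri-dist-above zero    r = cong tri (ℕ.+-identityʳ r)
tri-dist-above (suc n) r = trans (cong (tri-dist n) (ℕ.+-suc r n)) (tri-dist-above n r)

tri-even : ∀ k → tri (2 * k) + k ≡ tri k * 4
tri-even zero    = refl
tri-even (suc k) = begin
  tri (2 * suc k) + suc k                          ≡⟨ cong (λ i → tri i + suc k) (lemma₁ k) ⟩
  tri (2 * k) + suc (2 * k) + suc (suc (2 * k)) + suc k ≡⟨ lemma₂ (tri (2 * k)) k ⟩
  (tri (2 * k) + k) + suc k * 4                    ≡⟨ cong (_+ suc k * 4) (tri-even k) ⟩
  tri k * 4 + suc k * 4                            ≡⟨ sym (ℕ.*-distribʳ-+ 4 (tri k) (suc k)) ⟩
  tri (suc k) * 4                                  ∎
  where
  open ≡-Reasoning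
  lemma₁ : ∀ k → 2 * suc k ≡ suc (suc (2 * k))
  lemma₁ = solve-∀
  lemma₂ : ∀ x k → x + suc (2 * k) + suc (suc (2 * k)) + suc k ≡ (x + k) + suc k * 4
  lemma₂ = solve-∀

module Gaussian (s : ℕ) .{{_ : NonZero s}} where

  infix 9 Q^_
  Q^_ : ℕ → Series₂
  Q^ j = q^ (j * s)

  Q^-+ : ∀ i j → Q^ i ⋆ Q^ j ≈ Q^ (i + j)
  Q^-+ i j = ≈-trans (q^-+ (i * s) (j * s)) (≡⇒≈ (cong q^_ (sym (ℕ.*-distribʳ-+ s i j))))

  Q^-cong : ∀ {i j} → i ≡ j → Q^ i ≈ Q^ j
  Q^-cong refl = ≈-refl

  poch : ℕ → Series₂
  poch = ∏ (λ i → 1ₛ ⊕ Q^ suc i)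

  poch-coeff-0 : ∀ k → poch k 0 ≡ 1ℙ
  poch-coeff-0 k = ∏-coeff-0 _ k λ i →
    cong (1ℙ ℙ.+_) (q^-coeff-≢ (≢-sym (≢-nonZero⁻¹ (suc i * s) {{ℕ.m*n≢0 (suc i) s}})))

  -- gauss x y is the Gaussian binomial coefficient [x+y choose x] in the variable Q.
  gauss : ℕ → ℕ → Series₂
  gauss zero    y       = 1ₛ
  gauss (suc x) zero    = 1ₛ
  gauss (suc x) (suc y) = gauss x (suc y) ⊕ Q^ suc x ⋆ gauss (suc x) y

  gauss-poch-step : ∀ w g₁ g₂ cx cy qa qb qab → qa ⋆ qb ≈ qab →
    g₁ ⋆ (cx ⋆ (cy ⋆ (1ₛ ⊕ qb))) ≈ w → g₂ ⋆ ((cx ⋆ (1ₛ ⊕ qa)) ⋆ cy) ≈ w →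
    (g₁ ⊕ qa ⋆ g₂) ⋆ ((cx ⋆ (1ₛ ⊕ qa)) ⋆ (cy ⋆ (1ₛ ⊕ qb))) ≈ w ⋆ (1ₛ ⊕ qab)
  gauss-poch-step w g₁ g₂ cx cy qa qb qab qaqb h₁ h₂ = begin
    (g₁ ⊕ qa ⋆ g₂) ⋆ ((cx ⋆ (1ₛ ⊕ qa)) ⋆ (cy ⋆ (1ₛ ⊕ qb)))
      ≈⟨ solve 6 (λ g₁ g₂ cx cy qa qb →
            (g₁ :+ qa :* g₂) :* ((cx :* (con 1ℙ :+ qa)) :* (cy :* (con 1ℙ :+ qb)))
         := (g₁ :* (cx :* (cy :* (con 1ℙ :+ qb)))) :* (con 1ℙ :+ qa)
            :+ qa :* (con 1ℙ :+ qb) :* (g₂ :* ((cx :* (con 1ℙ :+ qa)) :* cy)))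
         ≈-refl g₁ g₂ cx cy qa qb ⟩
    (g₁ ⋆ (cx ⋆ (cy ⋆ (1ₛ ⊕ qb)))) ⋆ (1ₛ ⊕ qa) ⊕ qa ⋆ (1ₛ ⊕ qb) ⋆ (g₂ ⋆ ((cx ⋆ (1ₛ ⊕ qa)) ⋆ cy))
      ≈⟨ ⊕-cong (⋆-cong h₁ ≈-refl) (⋆-cong ≈-refl h₂) ⟩
    w ⋆ (1ₛ ⊕ qa) ⊕ qa ⋆ (1ₛ ⊕ qb) ⋆ w
      ≈⟨ solve 3 (λ w qa qb → w :* (con 1ℙ :+ qa) :+ qa :* (con 1ℙ :+ qb) :* w := w :* (con 1ℙ :+ qa :* qb))
           ≈-refl w qa qb ⟩
    w ⋆ (1ₛ ⊕ qa ⋆ qb)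
      ≈⟨ ⋆-cong ≈-refl (⊕-cong {1ₛ} ≈-refl qaqb) ⟩
    w ⋆ (1ₛ ⊕ qab) ∎
    where open ≈-Reasoning

  gauss-poch-step′ : ∀ w g₁ g₂ cx cy qa qb qab → qa ⋆ qb ≈ qab →
    g₁ ⋆ (cx ⋆ (cy ⋆ (1ₛ ⊕ qb))) ≈ w → g₂ ⋆ ((cx ⋆ (1ₛ ⊕ qa)) ⋆ cy) ≈ w →
    (qb ⋆ g₁ ⊕ g₂) ⋆ ((cx ⋆ (1ₛ ⊕ qa)) ⋆ (cy ⋆ (1ₛ ⊕ qb))) ≈ w ⋆ (1ₛ ⊕ qab)
  gauss-poch-step′ w g₁ g₂ cx cy qa qb qab qaqb h₁ h₂ = begin
    (qb ⋆ g₁ ⊕ g₂) ⋆ ((cx ⋆ (1ₛ ⊕ qa)) ⋆ (cy ⋆ (1ₛ ⊕ qb)))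
      ≈⟨ solve 6 (λ g₁ g₂ cx cy qa qb →
            (qb :* g₁ :+ g₂) :* ((cx :* (con 1ℙ :+ qa)) :* (cy :* (con 1ℙ :+ qb)))
         := qb :* (con 1ℙ :+ qa) :* (g₁ :* (cx :* (cy :* (con 1ℙ :+ qb))))
            :+ (g₂ :* ((cx :* (con 1ℙ :+ qa)) :* cy)) :* (con 1ℙ :+ qb))
         ≈-refl g₁ g₂ cx cy qa qb ⟩
    qb ⋆ (1ₛ ⊕ qa) ⋆ (g₁ ⋆ (cx ⋆ (cy ⋆ (1ₛ ⊕ qb)))) ⊕ (g₂ ⋆ ((cx ⋆ (1ₛ ⊕ qa)) ⋆ cy)) ⋆ (1ₛ ⊕ qb)
      ≈⟨ ⊕-cong (⋆-cong ≈-refl h₁) (⋆-cong h₂ ≈-refl) ⟩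
    qb ⋆ (1ₛ ⊕ qa) ⋆ w ⊕ w ⋆ (1ₛ ⊕ qb)
      ≈⟨ solve 3 (λ w qa qb → qb :* (con 1ℙ :+ qa) :* w :+ w :* (con 1ℙ :+ qb) := w :* (con 1ℙ :+ qa :* qb))
           ≈-refl w qa qb ⟩
    w ⋆ (1ₛ ⊕ qa ⋆ qb)
      ≈⟨ ⋆-cong ≈-refl (⊕-cong {1ₛ} ≈-refl qaqb) ⟩
    w ⋆ (1ₛ ⊕ qab) ∎
    where open ≈-Reasoning

  Q^-suc-+-suc : ∀ x y → Q^ suc x ⋆ Q^ suc y ≈ Q^ suc (suc (x + y))
  Q^-suc-+-suc x y = ≈-trans (Q^-+ (suc x) (suc y)) (Q^-cong (cong suc (ℕ.+-suc x y)))

  poch-cong : ∀ {i j} → i ≡ j → poch i ≈ poch j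
  poch-cong refl = ≈-refl

  gauss-poch : ∀ x y → gauss x y ⋆ (poch x ⋆ poch y) ≈ poch (x + y)
  gauss-poch zero    y       = ≈-trans (⋆-identityˡ _) (⋆-identityˡ _)
  gauss-poch (suc x) zero    =
    ≈-trans (⋆-identityˡ _) (≈-trans (⋆-identityʳ (poch (suc x))) (poch-cong (sym (ℕ.+-identityʳ (suc x)))))
  gauss-poch (suc x) (suc y) = ≈-trans
    (gauss-poch-step (poch (suc (x + y))) (gauss x (suc y)) (gauss (suc x) y) (poch x) (poch y)
       (Q^ suc x) (Q^ suc y) (Q^ suc (suc (x + y))) (Q^-suc-+-suc x y)
       (≈-trans (gauss-poch x (suc y)) (poch-cong (ℕ.+-suc x y)))
       (gauss-poch (suc x) y))
    (poch-cong (cong suc (sym (ℕ.+-suc x y))))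

  -- The second Pascal rule, obtained by cancelling (Q;Q)_(x+1) (Q;Q)_(y+1) in the product formula.
  gauss-pascal′ : ∀ x y → gauss (suc x) (suc y) ≈ Q^ suc y ⋆ gauss x (suc y) ⊕ gauss (suc x) y
  gauss-pascal′ x y n = ⋆-cancelˡ-≈[] u (cong₂ ℙ._*_ (poch-coeff-0 (suc x)) (poch-coeff-0 (suc y)))
    (λ k _ → same k) n ℕ.≤-refl
    where
    open ≈-Reasoning
    u = poch (suc x) ⋆ poch (suc y)
    g₁ = gauss x (suc y)
    g₂ = gauss (suc x) y
    same : u ⋆ gauss (suc x) (suc y) ≈ u ⋆ (Q^ suc y ⋆ g₁ ⊕ g₂)
    same = begin
      u ⋆ gauss (suc x) (suc y)           ≈⟨ ⋆-comm u _ ⟩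
      gauss (suc x) (suc y) ⋆ u           ≈⟨ gauss-poch (suc x) (suc y) ⟩
      poch (suc x + suc y)                ≈⟨ poch-cong (cong suc (ℕ.+-suc x y)) ⟩
      poch (suc (x + y)) ⋆ (1ₛ ⊕ Q^ suc (suc (x + y)))
        ≈⟨ ≈-sym (gauss-poch-step′ (poch (suc (x + y))) g₁ g₂ (poch x) (poch y)
             (Q^ suc x) (Q^ suc y) (Q^ suc (suc (x + y))) (Q^-suc-+-suc x y)
             (≈-trans (gauss-poch x (suc y)) (poch-cong (ℕ.+-suc x y)))
             (gauss-poch (suc x) y)) ⟩
      (Q^ suc y ⋆ g₁ ⊕ g₂) ⋆ u            ≈⟨ ⋆-comm _ u ⟩
      u ⋆ (Q^ suc y ⋆ g₁ ⊕ g₂)            ∎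

  -- binom N l is the Gaussian binomial coefficient [N choose l] in the variable Q.
  binom : ℕ → ℕ → Series₂
  binom zero    zero    = 1ₛ
  binom zero    (suc l) = 0ₛ
  binom (suc N) zero    = 1ₛ
  binom (suc N) (suc l) = binom N l ⊕ Q^ suc l ⋆ binom N (suc l)

  binom-0 : ∀ N → binom N 0 ≈ 1ₛ
  binom-0 zero    = ≈-refl
  binom-0 (suc N) = ≈-refl

  binom-> : ∀ N l → N < l → binom N l ≈ 0ₛ
  binom-> zero    (suc l) _         = ≈-refl
  binom-> (suc N) (suc l) (s≤s N<l) =
    ≈-trans (⊕-cong (binom-> N l N<l) (⋆-cong ≈-refl (binom-> N (suc l) (ℕ.m<n⇒m<1+n N<l))))
            (⋆-zeroʳ (Q^ suc l))

  binom-diag : ∀ k → binom k k ≈ 1ₛ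
  binom-diag zero    = ≈-refl
  binom-diag (suc k) =
    ≈-trans (⊕-cong (binom-diag k) (⋆-cong ≈-refl (binom-> k (suc k) ℕ.≤-refl)))
            (≈-trans (⊕-cong {1ₛ} ≈-refl (⋆-zeroʳ (Q^ suc k))) (⊕-identityʳ 1ₛ))

  binom≈gauss : ∀ x y → binom (x + y) x ≈ gauss x y
  binom≈gauss zero    y       = binom-0 y
  binom≈gauss (suc x) zero    =
    ≈-trans (≡⇒≈ (cong (λ N → binom N (suc x)) (ℕ.+-identityʳ (suc x)))) (binom-diag (suc x))
  binom≈gauss (suc x) (suc y) = ⊕-cong (binom≈gauss x (suc y))
    (⋆-cong ≈-refl (≈-trans (≡⇒≈ (cong (λ N → binom N (suc x)) (ℕ.+-suc x y))) (binom≈gauss (suc x) y)))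

  binom-pascal′ : ∀ N l → l ≤ N → binom (suc N) (suc l) ≈ Q^ (N ∸ l) ⋆ binom N l ⊕ binom N (suc l)
  binom-pascal′ N l l≤N = subst
    (λ M → binom (suc M) (suc l) ≈ Q^ (M ∸ l) ⋆ binom M l ⊕ binom M (suc l))
    (ℕ.m+[n∸m]≡n l≤N) (pascal′ (N ∸ l))
    where
    pascal′ : ∀ y → binom (suc (l + y)) (suc l) ≈ Q^ (l + y ∸ l) ⋆ binom (l + y) l ⊕ binom (l + y) (suc l)
    pascal′ y rewrite ℕ.m+n∸m≡n l y with y
    ... | zero  rewrite ℕ.+-identityʳ l = ≈-trans (binom-diag (suc l)) (≈-sym
            (≈-trans (⊕-cong (≈-trans (⋆-identityˡ (binom l l)) (binom-diag l)) (binom-> l (suc l) ℕ.≤-refl))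
                     (⊕-identityʳ 1ₛ)))
    ... | suc y = begin
      binom (suc l + suc y) (suc l)
        ≈⟨ binom≈gauss (suc l) (suc y) ⟩
      gauss (suc l) (suc y)
        ≈⟨ gauss-pascal′ l y ⟩
      Q^ suc y ⋆ gauss l (suc y) ⊕ gauss (suc l) y
        ≈⟨ ⊕-cong (⋆-cong ≈-refl (≈-sym (binom≈gauss l (suc y))))
                  (≈-trans (≈-sym (binom≈gauss (suc l) y)) (≡⇒≈ (cong (λ N → binom N (suc l)) (sym (ℕ.+-suc l y))))) ⟩
      Q^ suc y ⋆ binom (l + suc y) l ⊕ binom (l + suc y) (suc l) ∎
      where open ≈-Reasoning

  poch-≈[] : ∀ {d} x K → x ≤ K → d < suc x * s → poch K ≈[ d ] poch x
  poch-≈[] {d} x K x≤K d<Qx = subst (λ M → poch M ≈[ d ] poch x) (ℕ.m∸n+n≡m x≤K)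
    (∏-≈[]-stable _ x (K ∸ x) λ i x≤i → 1+q^-≈[]-1ₛ (ℕ.<-≤-trans d<Qx (ℕ.*-monoˡ-≤ s (s≤s x≤i))))

  gauss⋆poch-≈[]-1ₛ : ∀ {d} x y K → x + y ≤ K → d < suc x * s → d < suc y * s →
    gauss x y ⋆ poch K ≈[ d ] 1ₛ
  gauss⋆poch-≈[]-1ₛ {d} x y K x+y≤K d<Qx d<Qy = ⋆-cancelˡ-≈[] (poch K) (poch-coeff-0 K) (begin
    poch K ⋆ (gauss x y ⋆ poch K)
      ≈⟨ ≈⇒≈[] (solve 2 (λ c g → c :* (g :* c) := g :* (c :* c)) ≈-refl (poch K) (gauss x y)) ⟩
    gauss x y ⋆ (poch K ⋆ poch K)      ≈⟨ ⋆-cong-≈[] {f = gauss x y} (λ _ _ → refl)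
                                            (⋆-cong-≈[] (poch-≈[] x K x≤K′ d<Qx) (poch-≈[] y K y≤K d<Qy)) ⟩
    gauss x y ⋆ (poch x ⋆ poch y)      ≈⟨ ≈⇒≈[] (gauss-poch x y) ⟩
    poch (x + y)                       ≈⟨ ≈[]-sym (poch-≈[] (x + y) K x+y≤K d<Qx+y) ⟩
    poch K                             ≈⟨ ≈⇒≈[] (≈-sym (⋆-identityʳ (poch K))) ⟩
    poch K ⋆ 1ₛ                        ∎)
    where
    open ≈[]-Reasoning d
    x≤K′ = ℕ.≤-trans (ℕ.m≤m+n x y) x+y≤K
    y≤K = ℕ.≤-trans (ℕ.m≤n+m y x) x+y≤K
    d<Qx+y = ℕ.<-≤-trans d<Qx (ℕ.*-monoˡ-≤ s (s≤s (ℕ.m≤m+n x y)))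

  binom⋆poch-≈[]-1ₛ : ∀ {d} N l K → l ≤ N → N ≤ K → d < suc l * s → d < suc (N ∸ l) * s →
    binom N l ⋆ poch K ≈[ d ] 1ₛ
  binom⋆poch-≈[]-1ₛ N l K l≤N N≤K d<Ql d<QN-l =
    ≈[]-trans (≈⇒≈[] (⋆-cong (≈-trans (≡⇒≈ (cong (λ M → binom M l) (sym (ℕ.m+[n∸m]≡n l≤N)))) (binom≈gauss l (N ∸ l))) ≈-refl))
              (gauss⋆poch-≈[]-1ₛ l (N ∸ l) K (subst (_≤ K) (sym (ℕ.m+[n∸m]≡n l≤N)) N≤K) d<Ql d<QN-l)

  -- The coefficient of zˡ in ∏_{i<a} (1 + z Qⁱ) ∏_{i<b} (z + Q^(i+1)).
  tripleCoeff : ℕ → ℕ → ℕ → Series₂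
  tripleCoeff a b l = Q^ tri-dist b l ⋆ binom (a + b) l

  tripleCoeff-> : ∀ a b l → a + b < l → tripleCoeff a b l ≈ 0ₛ
  tripleCoeff-> a b l a+b<l = ≈-trans (⋆-cong ≈-refl (binom-> (a + b) l a+b<l)) (⋆-zeroʳ _)

  tripleCoeff-sucʳ-0 : ∀ a b → tripleCoeff a (suc b) 0 ≈ Q^ suc b ⋆ tripleCoeff a b 0
  tripleCoeff-sucʳ-0 a b = begin
    Q^ (tri b + suc b) ⋆ binom (a + suc b) 0    ≈⟨ ⋆-cong (Q^-cong (ℕ.+-comm (tri b) (suc b))) (binom-0 (a + suc b)) ⟩
    Q^ (suc b + tri b) ⋆ 1ₛ                      ≈⟨ ⋆-cong (≈-sym (Q^-+ (suc b) (tri b))) ≈-refl ⟩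
    (Q^ suc b ⋆ Q^ tri b) ⋆ 1ₛ                   ≈⟨ ⋆-assoc _ _ _ ⟩
    Q^ suc b ⋆ (Q^ tri b ⋆ 1ₛ)                   ≈⟨ ⋆-cong ≈-refl (⋆-cong ≈-refl (≈-sym (binom-0 (a + b)))) ⟩
    Q^ suc b ⋆ (Q^ tri b ⋆ binom (a + b) 0)      ∎
    where open ≈-Reasoning

  tripleCoeff-sucʳ : ∀ a b l →
    tripleCoeff a (suc b) (suc l) ≈ Q^ suc b ⋆ tripleCoeff a b (suc l) ⊕ 1ₛ ⋆ tripleCoeff a b l
  tripleCoeff-sucʳ a b l = begin
    Q^ tri-dist b l ⋆ binom (a + suc b) (suc l)
      ≈⟨ ⋆-cong ≈-refl (≡⇒≈ (cong (λ N → binom N (suc l)) (ℕ.+-suc a b))) ⟩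
    Q^ tri-dist b l ⋆ (B₀ ⊕ Q^ suc l ⋆ B₁)
      ≈⟨ solve 4 (λ q₀ qₛ b₀ b₁ → q₀ :* (b₀ :+ qₛ :* b₁) := q₀ :* b₀ :+ (q₀ :* qₛ) :* b₁) ≈-refl
           (Q^ tri-dist b l) (Q^ suc l) B₀ B₁ ⟩
    Q^ tri-dist b l ⋆ B₀ ⊕ (Q^ tri-dist b l ⋆ Q^ suc l) ⋆ B₁
      ≈⟨ ⊕-cong {Q^ tri-dist b l ⋆ B₀} ≈-refl (⋆-cong exponents ≈-refl) ⟩
    Q^ tri-dist b l ⋆ B₀ ⊕ (Q^ suc b ⋆ Q^ tri-dist b (suc l)) ⋆ B₁
      ≈⟨ solve 5 (λ q₀ qb q₁ b₀ b₁ → q₀ :* b₀ :+ (qb :* q₁) :* b₁ := qb :* (q₁ :* b₁) :+ con 1ℙ :* (q₀ :* b₀)) ≈-refl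
           (Q^ tri-dist b l) (Q^ suc b) (Q^ tri-dist b (suc l)) B₀ B₁ ⟩
    Q^ suc b ⋆ (Q^ tri-dist b (suc l) ⋆ B₁) ⊕ 1ₛ ⋆ (Q^ tri-dist b l ⋆ B₀) ∎
    where
    open ≈-Reasoning
    B₀ = binom (a + b) l
    B₁ = binom (a + b) (suc l)
    exponents : Q^ tri-dist b l ⋆ Q^ suc l ≈ Q^ suc b ⋆ Q^ tri-dist b (suc l)
    exponents = ≈-trans (Q^-+ (tri-dist b l) (suc l))
                (≈-trans (Q^-cong (tri-dist-suc b l)) (≈-sym (Q^-+ (suc b) (tri-dist b (suc l)))))

  tripleCoeff-sucˡ-0 : ∀ a b → tripleCoeff (suc a) b 0 ≈ 1ₛ ⋆ tripleCoeff a b 0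
  tripleCoeff-sucˡ-0 a b =
    ≈-trans (⋆-cong ≈-refl (≈-trans (binom-0 (suc (a + b))) (≈-sym (binom-0 (a + b))))) (≈-sym (⋆-identityˡ _))

  tripleCoeff-sucˡ : ∀ a b l →
    tripleCoeff (suc a) b (suc l) ≈ 1ₛ ⋆ tripleCoeff a b (suc l) ⊕ Q^ a ⋆ tripleCoeff a b l
  tripleCoeff-sucˡ a b l with l ≤? a + b
  ... | yes l≤a+b = begin
    Q^ t₁ ⋆ binom (suc (a + b)) (suc l)
      ≈⟨ ⋆-cong ≈-refl (binom-pascal′ (a + b) l l≤a+b) ⟩
    Q^ t₁ ⋆ (Q^ (a + b ∸ l) ⋆ B₀ ⊕ B₁)
      ≈⟨ solve 4 (λ q₁ qd b₀ b₁ → q₁ :* (qd :* b₀ :+ b₁) := con 1ℙ :* (q₁ :* b₁) :+ (q₁ :* qd) :* b₀) ≈-refl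
           (Q^ t₁) (Q^ (a + b ∸ l)) B₀ B₁ ⟩
    1ₛ ⋆ (Q^ t₁ ⋆ B₁) ⊕ (Q^ t₁ ⋆ Q^ (a + b ∸ l)) ⋆ B₀
      ≈⟨ ⊕-cong {1ₛ ⋆ (Q^ t₁ ⋆ B₁)} ≈-refl (≈-trans (⋆-cong exponents ≈-refl) (⋆-assoc _ _ _)) ⟩
    1ₛ ⋆ (Q^ t₁ ⋆ B₁) ⊕ Q^ a ⋆ (Q^ tri-dist b l ⋆ B₀) ∎
    where
    open ≈-Reasoning
    t₁ = tri-dist b (suc l)
    B₀ = binom (a + b) l
    B₁ = binom (a + b) (suc l)
    exponents : Q^ t₁ ⋆ Q^ (a + b ∸ l) ≈ Q^ a ⋆ Q^ tri-dist b l
    exponents = ≈-trans (Q^-+ t₁ (a + b ∸ l))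
                (≈-trans (Q^-cong (tri-dist-suc′ a b l l≤a+b)) (≈-sym (Q^-+ a (tri-dist b l))))
  ... | no l≰a+b = ≈-trans (tripleCoeff-> (suc a) b (suc l) (s≤s a+b<l)) (≈-sym
      (≈-trans (⊕-cong (≈-trans (⋆-cong ≈-refl (tripleCoeff-> a b (suc l) (ℕ.m<n⇒m<1+n a+b<l))) (⋆-zeroʳ 1ₛ))
                       (≈-trans (⋆-cong ≈-refl (tripleCoeff-> a b l a+b<l)) (⋆-zeroʳ (Q^ a))))
               (⊕-identityʳ 0ₛ)))
    where a+b<l = ℕ.≰⇒> l≰a+b

  tripleSum : ℕ → ℕ → Series₂
  tripleSum a b = poly (tripleCoeff a b) (suc (a + b))

  tripleSum-sucʳ : ∀ a b → tripleSum a (suc b) ≈ tripleSum a b ⋆ (q^ 1 ⊕ Q^ suc b)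
  tripleSum-sucʳ a b = begin
    poly (tripleCoeff a (suc b)) (suc (a + suc b))
      ≈⟨ ≡⇒≈ (cong (λ L → poly (tripleCoeff a (suc b)) (suc L)) (ℕ.+-suc a b)) ⟩
    poly (tripleCoeff a (suc b)) (suc (suc (a + b)))
      ≈⟨ poly-recurrence (tripleCoeff a b) (tripleCoeff a (suc b)) (Q^ suc b) 1ₛ (suc (a + b))
           (tripleCoeff-> a b (suc (a + b)) ℕ.≤-refl) (tripleCoeff-sucʳ-0 a b) (tripleCoeff-sucʳ a b) ⟩
    tripleSum a b ⋆ (Q^ suc b ⊕ q^ 1 ⋆ 1ₛ)
      ≈⟨ ⋆-cong ≈-refl (≈-trans (⊕-comm (Q^ suc b) (q^ 1 ⋆ 1ₛ)) (⊕-cong (⋆-identityʳ (q^ 1)) ≈-refl)) ⟩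
    tripleSum a b ⋆ (q^ 1 ⊕ Q^ suc b) ∎
    where open ≈-Reasoning

  tripleSum-sucˡ : ∀ a b → tripleSum (suc a) b ≈ tripleSum a b ⋆ (1ₛ ⊕ q^ 1 ⋆ Q^ a)
  tripleSum-sucˡ a b = poly-recurrence (tripleCoeff a b) (tripleCoeff (suc a) b) 1ₛ (Q^ a) (suc (a + b))
    (tripleCoeff-> a b (suc (a + b)) ℕ.≤-refl) (tripleCoeff-sucˡ-0 a b) (tripleCoeff-sucˡ a b)

  tripleSum-∏ : ∀ a b → tripleSum a b ≈ ∏ (λ i → 1ₛ ⊕ q^ 1 ⋆ Q^ i) a ⋆ ∏ (λ i → q^ 1 ⊕ Q^ suc i) b
  tripleSum-∏ zero    zero    =
    ≈-trans (⊕-identityʳ _) (≈-trans (⋆-identityˡ _) (≈-trans (⋆-identityˡ _) (≈-sym (⋆-identityˡ 1ₛ))))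
  tripleSum-∏ (suc a) zero    = ≈-trans (tripleSum-sucˡ a 0) (≈-trans (⋆-cong (tripleSum-∏ a 0) ≈-refl)
    (solve 2 (λ p f → (p :* con 1ℙ) :* f := (p :* f) :* con 1ℙ) ≈-refl (∏ (λ i → 1ₛ ⊕ q^ 1 ⋆ Q^ i) a) (1ₛ ⊕ q^ 1 ⋆ Q^ a)))
  tripleSum-∏ a       (suc b) =
    ≈-trans (tripleSum-sucʳ a b) (≈-trans (⋆-cong (tripleSum-∏ a b) ≈-refl) (⋆-assoc _ _ _))

-- Part (b)

-- The exponent of q in qˡ Q^(tri-dist n l) for Q = q⁴.
exponent : ℕ → ℕ → ℕ
exponent n l = l + tri-dist n l * 4

exponent-even : ∀ n k → k ≤ n → exponent n (n ∸ k) ≡ n + tri (2 * k)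
exponent-even n k k≤n = begin
  (n ∸ k) + tri-dist n (n ∸ k) * 4             ≡⟨ cong (λ b → (n ∸ k) + tri-dist b (n ∸ k) * 4) (sym (ℕ.m+[n∸m]≡n k≤n)) ⟩
  (n ∸ k) + tri-dist (k + (n ∸ k)) (n ∸ k) * 4 ≡⟨ cong (λ x → (n ∸ k) + x * 4) (tri-dist-below k (n ∸ k)) ⟩
  (n ∸ k) + tri k * 4                          ≡⟨ cong (_+_ (n ∸ k)) (sym (tri-even k)) ⟩
  (n ∸ k) + (tri (2 * k) + k)                  ≡⟨ lemma (n ∸ k) (tri (2 * k)) k ⟩
  (k + (n ∸ k)) + tri (2 * k)                  ≡⟨ cong (_+ tri (2 * k)) (ℕ.m+[n∸m]≡n k≤n) ⟩
  n + tri (2 * k)                              ∎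
  where
  open ≡-Reasoning
  lemma : ∀ a b k → a + (b + k) ≡ (k + a) + b
  lemma = solve-∀

exponent-odd : ∀ n r → exponent n (suc (r + n)) ≡ n + tri (suc (2 * r))
exponent-odd n r = begin
  suc (r + n) + tri-dist n (suc (r + n)) * 4   ≡⟨ cong (λ x → suc (r + n) + x * 4) (tri-dist-above n r) ⟩
  suc (r + n) + tri r * 4                      ≡⟨ cong (_+_ (suc (r + n))) (sym (tri-even r)) ⟩
  suc (r + n) + (tri (2 * r) + r)              ≡⟨ lemma r n (tri (2 * r)) ⟩
  n + (tri (2 * r) + suc (2 * r))              ∎
  where
  open ≡-Reasoning
  lemma : ∀ r n x → suc (r + n) + (x + r) ≡ n + (x + suc (2 * r))
  lemma = solve-∀

Index : ℕ → ℕ → ℕ → Set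
Index n l j = (∃ λ k → j ≡ 2 * k × l ≡ n ∸ k) ⊎ (∃ λ r → j ≡ suc (2 * r) × l ≡ suc (r + n))

exponent-index : ∀ n l → ∃ λ j → exponent n l ≡ n + tri j × Index n l j
exponent-index n l with l ≤? n
... | yes l≤n = 2 * k , trans (cong (exponent n) l≡n∸k) (exponent-even n k (ℕ.m∸n≤m n l)) , inj₁ (k , refl , l≡n∸k)
  where
  k = n ∸ l
  l≡n∸k = sym (ℕ.m∸[m∸n]≡n l≤n)
... | no l≰n = suc (2 * r) , trans (cong (exponent n) l≡1+r+n) (exponent-odd n r) , inj₂ (r , refl , l≡1+r+n)
  where
  r = l ∸ suc n
  l≡1+r+n = sym (trans (sym (ℕ.+-suc r n)) (ℕ.m∸n+n≡m (ℕ.≰⇒> l≰n)))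

Index-functional : ∀ {n l l′ j} → Index n l j → Index n l′ j → l ≡ l′
Index-functional (inj₁ (k , j≡2k , l≡)) (inj₁ (k′ , j≡2k′ , l′≡)) =
  trans l≡ (trans (cong (_ ∸_) (ℕ.*-cancelˡ-≡ k k′ 2 (trans (sym j≡2k) j≡2k′))) (sym l′≡))
Index-functional (inj₂ (r , j≡ , l≡)) (inj₂ (r′ , j≡′ , l′≡)) =
  trans l≡ (trans (cong (λ x → suc (x + _)) (ℕ.*-cancelˡ-≡ r r′ 2 (ℕ.suc-injective (trans (sym j≡) j≡′)))) (sym l′≡))
Index-functional (inj₁ (k , j≡ , _)) (inj₂ (r , j≡′ , _)) = contradiction (trans (sym j≡) j≡′) (ℕ.even≢odd k r)
Index-functional (inj₂ (r , j≡ , _)) (inj₁ (k , j≡′ , _)) = contradiction (trans (sym j≡′) j≡) (ℕ.even≢odd k r)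

exponent-injective : ∀ n {l l′} → exponent n l ≡ exponent n l′ → l ≡ l′
exponent-injective n {l} {l′} eq with exponent-index n l | exponent-index n l′
... | j , eₗ , iₗ | j′ , eₗ′ , iₗ′ = Index-functional iₗ (subst (Index n l′) (sym j≡j′) iₗ′)
  where j≡j′ = tri-injective (ℕ.+-cancelˡ-≡ n _ _ (trans (sym eₗ) (trans eq eₗ′)))

even⊎odd : ∀ j → (∃ λ k → j ≡ 2 * k) ⊎ (∃ λ r → j ≡ suc (2 * r))
even⊎odd zero    = inj₁ (0 , refl)
even⊎odd (suc j) with even⊎odd j
... | inj₁ (k , j≡2k)   = inj₂ (k , cong suc j≡2k)
... | inj₂ (r , j≡2r+1) = inj₁ (suc r , trans (cong suc j≡2r+1) (lemma r))
  where
  lemma : ∀ r → suc (suc (2 * r)) ≡ 2 * suc r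
  lemma = solve-∀

exponent-onto : ∀ n j → j < n → ∃ λ l → l < suc (n + n) × exponent n l ≡ n + tri j
exponent-onto n j j<n with even⊎odd j
... | inj₁ (k , j≡2k) = n ∸ k , s≤s (ℕ.≤-trans (ℕ.m∸n≤m n k) (ℕ.m≤m+n n n)) ,
      trans (exponent-even n k k≤n) (cong (λ i → n + tri i) (sym j≡2k))
  where
  k≤n = ℕ.≤-trans (ℕ.m≤m+n k (k + 0)) (ℕ.≤-trans (ℕ.≤-reflexive (sym j≡2k)) (ℕ.<⇒≤ j<n))
... | inj₂ (r , j≡2r+1) = suc (r + n) , s≤s (ℕ.+-monoˡ-< n r<n) ,
      trans (exponent-odd n r) (cong (λ i → n + tri i) (sym j≡2r+1))
  where
  r<n = ℕ.<-≤-trans (s≤s (ℕ.m≤m+n r (r + 0))) (ℕ.≤-trans (ℕ.≤-reflexive (sym j≡2r+1)) (ℕ.<⇒≤ j<n))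

-- Σ_{l ≤ 2n} q^(exponent n l); it is Σ_{j ≤ 2n} q^(n + tri j) after reindexing.
jacobiSum : ℕ → Series₂
jacobiSum n = ∑ (q^_ ∘ exponent n) (suc (n + n))

jacobiSum-coeff-tri : ∀ n j → j < n → jacobiSum n (n + tri j) ≡ 1ℙ
jacobiSum-coeff-tri n j j<n with exponent-onto n j j<n
... | l₀ , l₀<2n+1 , eₗ₀ = ∑-q^-coeff-unique (suc (n + n)) (exponent n) (n + tri j) l₀ l₀<2n+1 eₗ₀
        (λ l eₗ → exponent-injective n (trans eₗ (sym eₗ₀)))

jacobiSum-coeff-non-tri : ∀ n m → (∀ j → tri j ≢ m) → jacobiSum n (n + m) ≡ 0ℙ
jacobiSum-coeff-non-tri n m non-tri = ∑-q^-coeff-∉ (suc (n + n)) (exponent n) (n + m) λ l _ eₗ →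
  let (j , eₗ′ , _) = exponent-index n l in non-tri j (ℕ.+-cancelˡ-≡ n _ _ (trans (sym eₗ′) eₗ))

Triangular : ℕ → Set
Triangular m = ∃ λ j → 2 * m ≡ j * suc j

jacobiSum-coeff-triangular : ∀ m → Triangular m → jacobiSum (suc m) (suc m + m) ≡ 1ℙ
jacobiSum-coeff-triangular m (j , 2m≡j[j+1]) = subst (λ x → jacobiSum (suc m) (suc m + x) ≡ 1ℙ) tri[j]≡m
  (jacobiSum-coeff-tri (suc m) j (s≤s (subst (j ≤_) tri[j]≡m (n≤tri j))))
  where tri[j]≡m = ℕ.*-cancelˡ-≡ (tri j) m 2 (trans (tri-double j) (sym 2m≡j[j+1]))

jacobiSum-coeff-non-triangular : ∀ m → ¬ Triangular m → jacobiSum (suc m) (suc m + m) ≡ 0ℙ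
jacobiSum-coeff-non-triangular m non-tri = jacobiSum-coeff-non-tri (suc m) m
  (λ j tri[j]≡m → non-tri (j , trans (cong (2 *_) (sym tri[j]≡m)) (tri-double j)))

open Gaussian 4

eulerClass : ℕ → ℕ → Series₂
eulerClass k = ∏ (λ i → 1+q^ (k + i * 4))

eulerOdd : ℕ → Series₂
eulerOdd n = eulerClass 1 n ⋆ eulerClass 3 n

euler₂-*4 : ∀ n → euler₂ (n * 4) ≈ eulerOdd n ⋆ (eulerClass 2 n ⋆ eulerClass 4 n)
euler₂-*4 n = begin
  euler₂ (n * 4)
    ≈⟨ ∏-*4 (λ i → 1+q^ suc i) n ⟩
  ∏ (λ i → 1+q^ (1 + i * 4) ⋆ 1+q^ (2 + i * 4) ⋆ 1+q^ (3 + i * 4) ⋆ 1+q^ (4 + i * 4)) n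
    ≈⟨ ≈-trans (∏-⋆ _ _ n) (⋆-cong (≈-trans (∏-⋆ _ _ n) (⋆-cong (∏-⋆ _ _ n) ≈-refl)) ≈-refl) ⟩
  eulerClass 1 n ⋆ eulerClass 2 n ⋆ eulerClass 3 n ⋆ eulerClass 4 n
    ≈⟨ solve 4 (λ a b c d → a :* b :* c :* d := (a :* c) :* (b :* d)) ≈-refl
         (eulerClass 1 n) (eulerClass 2 n) (eulerClass 3 n) (eulerClass 4 n) ⟩
  eulerOdd n ⋆ (eulerClass 2 n ⋆ eulerClass 4 n) ∎
  where open ≈-Reasoning

dilate-euler₂-*2 : ∀ n → dilate (euler₂ (n * 2)) ≈ eulerClass 2 n ⋆ eulerClass 4 n
dilate-euler₂-*2 n = begin
  dilate (euler₂ (n * 2))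
    ≈⟨ dilate-∏-1+q^ suc (n * 2) ⟩
  ∏ (λ i → 1+q^ (suc i + suc i)) (n * 2)
    ≈⟨ ∏-*2 _ n ⟩
  ∏ (λ i → 1+q^ (suc (i * 2) + suc (i * 2)) ⋆ 1+q^ (suc (1 + i * 2) + suc (1 + i * 2))) n
    ≈⟨ ∏-cong n (λ i → ⋆-cong (1+q^-cong (lemma₁ i)) (1+q^-cong (lemma₂ i))) ⟩
  ∏ (λ i → 1+q^ (2 + i * 4) ⋆ 1+q^ (4 + i * 4)) n
    ≈⟨ ∏-⋆ _ _ n ⟩
  eulerClass 2 n ⋆ eulerClass 4 n ∎
  where
  open ≈-Reasoning
  lemma₁ : ∀ i → suc (i * 2) + suc (i * 2) ≡ 2 + i * 4
  lemma₁ = solve-∀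
  lemma₂ : ∀ i → suc (1 + i * 2) + suc (1 + i * 2) ≡ 4 + i * 4
  lemma₂ = solve-∀

dilate²-euler₂ : ∀ K → dilate (dilate (euler₂ K)) ≈ poch K
dilate²-euler₂ K = ≈-trans (dilate-cong (dilate-∏-1+q^ suc K))
  (≈-trans (dilate-∏-1+q^ (λ i → suc i + suc i) K) (∏-cong K (λ i → 1+q^-cong (lemma i))))
  where
  lemma : ∀ i → (suc i + suc i) + (suc i + suc i) ≡ suc i * 4
  lemma = solve-∀

tripleSum-diagonal : ∀ n → tripleSum n n ≈ q^ n ⋆ eulerOdd n
tripleSum-diagonal n = begin
  tripleSum n n
    ≈⟨ tripleSum-∏ n n ⟩
  ∏ (λ i → 1ₛ ⊕ q^ 1 ⋆ Q^ i) n ⋆ ∏ (λ i → q^ 1 ⊕ Q^ suc i) n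
    ≈⟨ ⋆-cong (∏-cong n (λ i → ⊕-cong {1ₛ} ≈-refl (q^-+ 1 (i * 4)))) (≈-trans (∏-cong n factor) (∏-⋆ _ _ n)) ⟩
  eulerClass 1 n ⋆ (∏ (λ _ → q^ 1) n ⋆ eulerClass 3 n)
    ≈⟨ ⋆-cong ≈-refl (⋆-cong (∏-q^1 n) ≈-refl) ⟩
  eulerClass 1 n ⋆ (q^ n ⋆ eulerClass 3 n)
    ≈⟨ solve 3 (λ a x c → a :* (x :* c) := x :* (a :* c)) ≈-refl (eulerClass 1 n) (q^ n) (eulerClass 3 n) ⟩
  q^ n ⋆ eulerOdd n ∎
  where
  open ≈-Reasoning
  factor : ∀ i → q^ 1 ⊕ Q^ suc i ≈ q^ 1 ⋆ 1+q^ (3 + i * 4)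
  factor i = ≈-sym (≈-trans (⋆-distribˡ (q^ 1) 1ₛ (q^ (3 + i * 4)))
                            (⊕-cong (⋆-identityʳ (q^ 1)) (q^-+ 1 (3 + i * 4))))

exponent-≥-below : ∀ n l → l ≤ n → n + (n ∸ l) ≤ exponent n l
exponent-≥-below n l l≤n = subst (n + k ≤_) (sym eₗ) (ℕ.+-monoʳ-≤ n (ℕ.≤-trans (ℕ.m≤m+n k (k + 0)) (n≤tri (2 * k))))
  where
  k = n ∸ l
  eₗ : exponent n l ≡ n + tri (2 * k)
  eₗ = trans (cong (exponent n) (sym (ℕ.m∸[m∸n]≡n l≤n))) (exponent-even n k (ℕ.m∸n≤m n l))

n≤suc[n]*4 : ∀ n → n ≤ suc n * 4
n≤suc[n]*4 n = ℕ.≤-trans (ℕ.n≤1+n n) (ℕ.m≤m*n (suc n) 4)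

exponent-bound₁ : ∀ n l → n + n ≤ exponent n l + suc l * 4
exponent-bound₁ n l with l ≤? n
... | yes l≤n = begin
  n + n                  ≡⟨ cong (_+_ n) (sym (ℕ.m∸n+n≡m l≤n)) ⟩
  n + ((n ∸ l) + l)      ≡⟨ sym (ℕ.+-assoc n (n ∸ l) l) ⟩
  (n + (n ∸ l)) + l      ≤⟨ ℕ.+-mono-≤ (exponent-≥-below n l l≤n) (n≤suc[n]*4 l) ⟩
  exponent n l + suc l * 4 ∎
  where open ℕ.≤-Reasoning
... | no l≰n = ℕ.+-mono-≤ (ℕ.≤-trans n≤l (ℕ.m≤m+n l _)) (ℕ.≤-trans n≤l (n≤suc[n]*4 l))
  where n≤l = ℕ.<⇒≤ (ℕ.≰⇒> l≰n)

exponent-bound₂ : ∀ n l → l ≤ n + n → n + n ≤ exponent n l + suc (n + n ∸ l) * 4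
exponent-bound₂ n l l≤2n with l ≤? n
... | yes l≤n = ℕ.+-mono-≤ (ℕ.≤-trans (ℕ.m≤m+n n (n ∸ l)) (exponent-≥-below n l l≤n))
    (ℕ.≤-trans (subst (_≤ n + n ∸ l) (ℕ.m+n∸n≡m n n) (ℕ.∸-monoʳ-≤ (n + n) l≤n)) (n≤suc[n]*4 (n + n ∸ l)))
... | no _ = begin
  n + n                                 ≡⟨ sym (ℕ.m+[n∸m]≡n l≤2n) ⟩
  l + (n + n ∸ l)                       ≤⟨ ℕ.+-mono-≤ (ℕ.m≤m+n l _) (n≤suc[n]*4 (n + n ∸ l)) ⟩
  exponent n l + suc (n + n ∸ l) * 4    ∎
  where open ℕ.≤-Reasoning

tripleSum⋆poch≈[]jacobiSum : ∀ {n d} → d < n + n → tripleSum n n ⋆ poch (n * 2) ≈[ d ] jacobiSum n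
tripleSum⋆poch≈[]jacobiSum {n} {d} d<2n = ≈[]-trans
  (≈⇒≈[] (≈-sym (∑-⋆ʳ (poch (n * 2)) (λ l → q^ l ⋆ tripleCoeff n n l) (suc (n + n)))))
  (∑-cong-≈[] (suc (n + n)) term)
  where
  term : ∀ l → l < suc (n + n) → (q^ l ⋆ tripleCoeff n n l) ⋆ poch (n * 2) ≈[ d ] q^ exponent n l
  term l (s≤s l≤2n) = ≈[]-trans (≈⇒≈[] regroup) (≈[]-trans
    (≈[]-weaken (ℕ.m≤n+m∸n d e) (q^⋆-cong-≈[] e binom⋆poch≈[]1))
    (≈⇒≈[] (⋆-identityʳ (q^ e))))
    where
    e = exponent n l
    B = binom (n + n) l
    regroup : (q^ l ⋆ (Q^ tri-dist n l ⋆ B)) ⋆ poch (n * 2) ≈ q^ e ⋆ (B ⋆ poch (n * 2))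
    regroup = ≈-trans
      (solve 4 (λ x q b c → (x :* (q :* b)) :* c := (x :* q) :* (b :* c)) ≈-refl (q^ l) (Q^ tri-dist n l) B (poch (n * 2)))
      (⋆-cong (q^-+ l (tri-dist n l * 4)) ≈-refl)
    d<2n≤ : ∀ {x} .{{_ : NonZero x}} → n + n ≤ e + x → d ∸ e < x
    d<2n≤ 2n≤ = ℕ.m<n+o⇒m∸n<o d e (ℕ.<-≤-trans d<2n 2n≤)
    binom⋆poch≈[]1 : B ⋆ poch (n * 2) ≈[ d ∸ e ] 1ₛ
    binom⋆poch≈[]1 = binom⋆poch-≈[]-1ₛ (n + n) l (n * 2) l≤2n (ℕ.≤-reflexive (lemma n))
      (d<2n≤ (exponent-bound₁ n l)) (d<2n≤ (exponent-bound₂ n l l≤2n))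
      where
      lemma : ∀ n → n + n ≡ n * 2
      lemma = solve-∀

^6≈dilate : ∀ f → f ^ 6 ≈ dilate (f ⋆ dilate f)
^6≈dilate f = begin
  f ^ 6
    ≈⟨ solve 1 (λ u → con 1ℙ :* u :* u :* u :* u :* u :* u := (u :* u) :* ((u :* u) :* (u :* u))) ≈-refl f ⟩
  (f ⋆ f) ⋆ ((f ⋆ f) ⋆ (f ⋆ f))
    ≈⟨ ⋆-cong (frobenius f) (≈-trans (⋆-cong (frobenius f) (frobenius f)) (frobenius (dilate f))) ⟩
  dilate f ⋆ dilate (dilate f)            ≈⟨ ≈-sym (dilate-⋆ f (dilate f)) ⟩
  dilate (f ⋆ dilate f)                   ∎
  where open ≈-Reasoning

euler₂⋆dilate≈[]eulerOdd⋆poch : ∀ m → let E = euler₂ (suc (m + m)) in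
  E ⋆ dilate E ≈[ m ] eulerOdd (suc m) ⋆ poch (suc m * 2)
euler₂⋆dilate≈[]eulerOdd⋆poch m = begin
  E ⋆ dilate E                      ≈⟨ ⋆-cong-≈[] E≈[]E₄ (dilate-cong-≈[] E≈[]E₄) ⟩
  E₄ ⋆ dilate E₄                    ≈⟨ ⋆-cong-≈[] {f = E₄} (λ _ _ → refl) (dilate-cong-≈[] E₄≈[]E₂) ⟩
  E₄ ⋆ dilate E₂
    ≈⟨ ≈⇒≈[] (⋆-cong (≈-trans (euler₂-*4 n) (⋆-cong ≈-refl (≈-sym (dilate-euler₂-*2 n)))) ≈-refl) ⟩
  (eulerOdd n ⋆ dilate E₂) ⋆ dilate E₂ ≈⟨ ≈⇒≈[] (⋆-assoc (eulerOdd n) (dilate E₂) (dilate E₂)) ⟩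
  eulerOdd n ⋆ (dilate E₂ ⋆ dilate E₂)
    ≈⟨ ≈⇒≈[] (⋆-cong ≈-refl (≈-trans (frobenius (dilate E₂)) (dilate²-euler₂ (n * 2)))) ⟩
  eulerOdd n ⋆ poch (n * 2)         ∎
  where
  open ≈[]-Reasoning m
  n = suc m
  E = euler₂ (suc (m + m))
  E₂ = euler₂ (n * 2)
  E₄ = euler₂ (n * 4)
  E≈[]E₄ : E ≈[ m ] E₄
  E≈[]E₄ = ≈[]-trans (euler₂-≈[] (s≤s (ℕ.m≤m+n m m))) (≈[]-sym (euler₂-≈[] (ℕ.m≤m*n n 4)))
  E₄≈[]E₂ : E₄ ≈[ m ] E₂
  E₄≈[]E₂ = ≈[]-trans (euler₂-≈[] (ℕ.m≤m*n n 4)) (≈[]-sym (euler₂-≈[] (ℕ.m≤m*n n 2)))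

τ6-parity : ∀ m → parityℤ (τ 6 (suc (m + m))) ≡ jacobiSum (suc m) (suc m + m)
τ6-parity m = begin
  parityℤ (τ 6 (suc (m + m)))            ≡⟨ parityℤ-τ 6 (m + m) ⟩
  (E ^ 6) (m + m)                        ≡⟨ ^6≈dilate E (m + m) ⟩
  dilate (E ⋆ dilate E) (m + m)          ≡⟨ dilate-coeff-double (E ⋆ dilate E) m ⟩
  (E ⋆ dilate E) m                       ≡⟨ euler₂⋆dilate≈[]eulerOdd⋆poch m m ℕ.≤-refl ⟩
  (eulerOdd n ⋆ poch (n * 2)) m          ≡⟨ sym (q^⋆-coeff-+ n (eulerOdd n ⋆ poch (n * 2)) m) ⟩
  (q^ n ⋆ (eulerOdd n ⋆ poch (n * 2))) (n + m) ≡⟨ sym (⋆-assoc (q^ n) (eulerOdd n) (poch (n * 2)) (n + m)) ⟩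
  ((q^ n ⋆ eulerOdd n) ⋆ poch (n * 2)) (n + m) ≡⟨ ⋆-cong (≈-sym (tripleSum-diagonal n)) ≈-refl (n + m) ⟩
  (tripleSum n n ⋆ poch (n * 2)) (n + m)
    ≡⟨ tripleSum⋆poch≈[]jacobiSum {n} (ℕ.+-monoʳ-< n ℕ.≤-refl) (n + m) ℕ.≤-refl ⟩
  jacobiSum n (n + m)                    ∎
  where
  open ≡-Reasoning
  n = suc m
  E = euler₂ (suc (m + m))

2n+1≡1+n+n : ∀ n → 2 * n + 1 ≡ suc (n + n)
2n+1≡1+n+n = solve-∀

mainTheorem7 : (n : ℕ) → 0 < n →
    (+ 2 ∣ (τ 14 (2 * n + 1) ℤ.- + R 8 n))
    × ((∃ λ m → 2 * n ≡ m * suc m) → + 2 ∣ (τ 6 (2 * n + 1) ℤ.- ℤ.1ℤ))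
    × ((¬ ∃ λ m → 2 * n ≡ m * suc m) → + 2 ∣ τ 6 (2 * n + 1))
mainTheorem7 n _ rewrite 2n+1≡1+n+n n =
    parityℤ≡⇒2∣- {τ 14 (suc (n + n))} (τ14-parity n)
  , (λ triangular → parityℤ≡⇒2∣- {τ 6 (suc (n + n))}
       (trans (τ6-parity n) (jacobiSum-coeff-triangular n triangular)))
  , (λ non-triangular → parityℤ≡0ℙ⇒2∣ (τ 6 (suc (n + n)))
       (trans (τ6-parity n) (jacobiSum-coeff-non-triangular n non-triangular)))
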